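{- For every $v\equiv 1$ or $3 \pmod 6$ with $v\neq 7$ (and $v>3$), there exists a $3$-way $\frac{v-1}{2}$-homogeneous $(v,3,2)$ Steiner trade of volume $v(v-1)/6$.
   Context: Let $V$ be a finite set with $v$ elements and let $t<k<v$ be positive integers (standing assumption in the definition of trades). A $\mu$-way $(v,k,t)$ trade $T=\{T_1,\dots,T_\mu\}$ of volume $m$ consists of $\mu$ pairwise disjoint collections $T_1,\dots,T_\mu$, each of $m$ blocks ($k$-subsets of $V$), such that every $t$-subset of $V$ is contained in the same number of blocks in each $T_i$. The foundation $\mathrm{found}(T)$ is the set of elements covered by the blocks. It is a Steiner trade if every $t$-subset of $\mathrm{found}(T)$ is in at most one block of each $T_i$, and $d$-homogeneous if every element of $V$ lies in exactly $d$ blocks of each $T_i$. -}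

module Defs where

open import Data.Nat using (ℕ; zero; suc; _+_; _<_; _≤_)
open import Data.Bool using (Bool; true; false)
open import Data.Fin using (Fin; zero; suc)
open import Data.Fin.Subset using (Subset; _⊆_; _∈_; ∣_∣; ⋃)
open import Data.Fin.Subset.Properties using (_⊆?_; _∈?_)
open import Data.List using (List; map; allFin)
open import Data.Product using (Σ; _×_)
open import Relation.Nullary using (¬_)
open import Relation.Nullary.Decidable using (⌊_⌋)
open import Relation.Binary.PropositionalEquality using (_≡_; _≢_)

countF : ∀ {m} → (Fin m → Bool) → ℕ
countF {zero}  p = 0
countF {suc m} p with p zero
... | true  = suc (countF (λ j → p (suc j)))
... | false = countF (λ j → p (suc j))

-- A μ-way (v,k,t) trade of volume m on V = Fin v.
-- T_i is given by blocks i : Fin m → Subset v (a set of m distinct k-subsets).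
record Trade (μ v k t m : ℕ) : Set where
  field
    t<k        : t < k
    k<v        : k < v
    blocks     : Fin μ → Fin m → Subset v
    block-size : ∀ i j → ∣ blocks i j ∣ ≡ k
    distinct   : ∀ i j j′ → blocks i j ≡ blocks i j′ → j ≡ j′
    disjoint   : ∀ i i′ j j′ → i ≢ i′ → blocks i j ≢ blocks i′ j′
  occ : Fin μ → Subset v → ℕ
  occ i S = countF (λ j → ⌊ S ⊆? blocks i j ⌋)
  deg : Fin μ → Fin v → ℕ
  deg i x = countF (λ j → ⌊ x ∈? blocks i j ⌋)
  field
    balanced   : ∀ (S : Subset v) → ∣ S ∣ ≡ t → ∀ i i′ → occ i S ≡ occ i′ S
  found : Subset v
  found = ⋃ (Data.List.concatMap (λ i → map (blocks i) (allFin m)) (allFin μ))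

open Trade public

IsSteiner : ∀ {μ v k t m} → Trade μ v k t m → Set
IsSteiner {μ} {v} {k} {t} T =
  ∀ (S : Subset v) → ∣ S ∣ ≡ t → S ⊆ found T → ∀ (i : Fin μ) → occ T i S ≤ 1

IsHomogeneous : ∀ {μ v k t m} → ℕ → Trade μ v k t m → Set
IsHomogeneous {μ} {v} d T = ∀ (x : Fin v) (i : Fin μ) → deg T i x ≡ d

module Submission where

-- A Steiner triple system on v points has v(v − 1)/6 blocks, covers
-- every pair exactly once and every point (v − 1)/2 times.  Three such
-- systems on the same points with no block in common therefore form the
-- required trade: every pair count is 1 in each of them.  Triple systems are
-- handled as Steiner quasigroups (x ∘ x = x, x ∘ y = y ∘ x, x ∘ (x ∘ y) = y,
-- blocks {x, y, x ∘ y}); two of them share no block iff they never agree on a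
-- pair of distinct points.  Disjoint copies of one system are obtained by
-- translating its three "levels" by amounts whose differences are distinct.

open import Data.Nat using (ℕ)

-- Everything reduces to three principles:
-- counts are preserved by bijections between the "true" parts of two
-- predicates, they add up over disjoint disjunctions, and a count is the
-- sum of the 0/1 indicators (so double counting is a swap of two sums).
module Counting where

  open import Defs using (countF)
  open import Data.Nat using (ℕ; zero; suc; _+_; _*_; _≤_)
  open import Data.Nat.Properties using (+-suc; ≤-antisym; +-0-commutativeMonoid)
  open import Data.Bool using (Bool; true; false; _∨_; _∧_; not)
  open import Relation.Nullary using (¬_; contradiction)
  open import Data.Bool.Properties using () renaming (_≟_ to _≟ᵇ_)
  open import Axiom.UniquenessOfIdentityProofs using (module Decidable⇒UIP)
  open import Data.Fin using (Fin; zero; suc)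
  open import Data.Fin.Properties using (injective⇒≤; suc-injective)
  open import Data.Product using (Σ; _×_; _,_)
  open import Data.Sum using (_⊎_; inj₁; inj₂)
  open import Relation.Binary.PropositionalEquality
  open import Algebra.Properties.CommutativeMonoid.Sum +-0-commutativeMonoid public
    using (sum; sum-cong-≗; ∑-comm)

  select : ∀ {a} (p : Fin a → Bool) → Fin (countF p) → Fin a
  select {suc a} p j with p zero
  select {suc a} p zero    | true  = zero
  select {suc a} p (suc j) | true  = suc (select (λ i → p (suc i)) j)
  select {suc a} p j       | false = suc (select (λ i → p (suc i)) j)

  select-true : ∀ {a} (p : Fin a → Bool) j → p (select p j) ≡ true
  select-true {suc a} p j with p zero in eq
  select-true {suc a} p zero    | true  = eq
  select-true {suc a} p (suc j) | true  = select-true (λ i → p (suc i)) j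
  select-true {suc a} p j       | false = select-true (λ i → p (suc i)) j

  select-injective : ∀ {a} (p : Fin a → Bool) j j′ → select p j ≡ select p j′ → j ≡ j′
  select-injective {suc a} p j j′ e with p zero
  select-injective {suc a} p zero    zero     e  | true = refl
  select-injective {suc a} p (suc j) (suc j′) e  | true =
    cong suc (select-injective _ j j′ (suc-injective e))
  select-injective {suc a} p j j′ e | false = select-injective _ j j′ (suc-injective e)

  rank : ∀ {a} (p : Fin a → Bool) (i : Fin a) → p i ≡ true → Fin (countF p)
  rank {suc a} p zero e with p zero
  rank {suc a} p zero e  | true  = zero
  rank {suc a} p zero () | false
  rank {suc a} p (suc i) e with p zero
  rank {suc a} p (suc i) e | true  = suc (rank (λ i → p (suc i)) i e)
  rank {suc a} p (suc i) e | false = rank (λ i → p (suc i)) i e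

  select-rank : ∀ {a} (p : Fin a → Bool) i (e : p i ≡ true) → select p (rank p i e) ≡ i
  select-rank {suc a} p zero e with p zero
  select-rank {suc a} p zero e  | true  = refl
  select-rank {suc a} p zero () | false
  select-rank {suc a} p (suc i) e with p zero
  select-rank {suc a} p (suc i) e | true  = cong suc (select-rank (λ i → p (suc i)) i e)
  select-rank {suc a} p (suc i) e | false = cong suc (select-rank (λ i → p (suc i)) i e)

  ∧-intro : ∀ {x y} → x ≡ true → y ≡ true → x ∧ y ≡ true
  ∧-intro refl refl = refl

  ∧-elim : ∀ {x y} → x ∧ y ≡ true → x ≡ true × y ≡ true
  ∧-elim {true} {true} _ = refl , refl

  ∨-introˡ : ∀ {x} y → x ≡ true → x ∨ y ≡ true
  ∨-introˡ y refl = refl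

  ∨-introʳ : ∀ x {y} → y ≡ true → x ∨ y ≡ true
  ∨-introʳ true  _ = refl
  ∨-introʳ false e = e

  ∨-elim : ∀ {x y} → x ∨ y ≡ true → x ≡ true ⊎ y ≡ true
  ∨-elim {true}  _ = inj₁ refl
  ∨-elim {false} e = inj₂ e

  not-true : ∀ {x} → not x ≡ true → x ≡ false
  not-true {false} _ = refl

  ≢true : ∀ {x} → ¬ (x ≡ true) → x ≡ false
  ≢true {true}  ¬e = contradiction refl ¬e
  ≢true {false} _  = refl

  count-≤ : ∀ {a b} (p : Fin a → Bool) (q : Fin b → Bool) (f : ∀ i → p i ≡ true → Fin b) →
    (∀ i e → q (f i e) ≡ true) → (∀ i i′ e e′ → f i e ≡ f i′ e′ → i ≡ i′) → countF p ≤ countF q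
  count-≤ p q f pq f-inj = injective⇒≤ {f = g} g-inj
    where
    g : Fin (countF p) → Fin (countF q)
    g j = rank q (f (select p j) (select-true p j)) (pq _ _)
    g-inj : ∀ {j j′} → g j ≡ g j′ → j ≡ j′
    g-inj {j} {j′} e = select-injective p j j′ (f-inj _ _ (select-true p j) (select-true p j′)
      (trans (sym (select-rank q _ _)) (trans (cong (select q) e) (select-rank q _ _))))

  proof-irrelevant : ∀ {a} {B : Set} {q : Fin a → Bool} (g : ∀ j → q j ≡ true → B) {i i′} →
    i ≡ i′ → (e : q i ≡ true) (e′ : q i′ ≡ true) → g i e ≡ g i′ e′
  proof-irrelevant g refl e e′ = cong (g _) (Decidable⇒UIP.≡-irrelevant _≟ᵇ_ e e′)

  count-bij : ∀ {a b} (p : Fin a → Bool) (q : Fin b → Bool)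
    (f : ∀ i → p i ≡ true → Fin b) (g : ∀ j → q j ≡ true → Fin a) →
    (pq : ∀ i e → q (f i e) ≡ true) → (qp : ∀ j e → p (g j e) ≡ true) →
    (∀ i e → g (f i e) (pq i e) ≡ i) → (∀ j e → f (g j e) (qp j e) ≡ j) → countF p ≡ countF q
  count-bij p q f g pq qp gf fg = ≤-antisym
    (count-≤ p q f pq (λ i i′ e e′ eq →
      trans (sym (gf i e)) (trans (proof-irrelevant g eq _ _) (gf i′ e′))))
    (count-≤ q p g qp (λ j j′ e e′ eq →
      trans (sym (fg j e)) (trans (proof-irrelevant f eq _ _) (fg j′ e′))))

  count-⇔ : ∀ {a} (p q : Fin a → Bool) →
    (∀ i → p i ≡ true → q i ≡ true) → (∀ i → q i ≡ true → p i ≡ true) → countF p ≡ countF q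
  count-⇔ p q f g = count-bij p q (λ i _ → i) (λ i _ → i) f g (λ _ _ → refl) (λ _ _ → refl)

  count-≗ : ∀ {a} (p q : Fin a → Bool) → (∀ i → p i ≡ q i) → countF p ≡ countF q
  count-≗ p q e = count-⇔ p q (λ i pi → trans (sym (e i)) pi) (λ i qi → trans (e i) qi)

  count-unique : ∀ {a} (p : Fin a → Bool) (i : Fin a) →
    p i ≡ true → (∀ j → p j ≡ true → j ≡ i) → countF p ≡ 1
  count-unique p i pi unique = count-bij p (λ (_ : Fin 1) → true) (λ _ _ → zero) (λ _ _ → i)
    (λ _ _ → refl) (λ _ _ → pi) (λ j pj → sym (unique j pj)) (λ { zero _ → refl })

  count-∨ : ∀ {a} (p q : Fin a → Bool) → (∀ i → p i ≡ true → q i ≡ false) →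
    countF (λ i → p i ∨ q i) ≡ countF p + countF q
  count-∨ {zero} p q disj = refl
  count-∨ {suc a} p q disj with p zero in e₁ | q zero in e₂
  ... | true  | true  with () ← trans (sym (disj zero e₁)) e₂
  ... | true  | false = cong suc (count-∨ _ _ (λ i → disj (suc i)))
  ... | false | true  = trans (cong suc (count-∨ _ _ (λ i → disj (suc i)))) (sym (+-suc _ _))
  ... | false | false = count-∨ _ _ (λ i → disj (suc i))

  count-complement : ∀ {a} (p : Fin a → Bool) → countF p + countF (λ i → not (p i)) ≡ a
  count-complement {zero} p = refl
  count-complement {suc a} p with p zero
  ... | true  = cong suc (count-complement (λ i → p (suc i)))
  ... | false = trans (+-suc _ _) (cong suc (count-complement (λ i → p (suc i))))

  count-two : ∀ {a} (p : Fin a → Bool) → countF p ≡ 2 →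
    Σ (Fin a) λ x → Σ (Fin a) λ y →
      x ≢ y × p x ≡ true × p y ≡ true × (∀ z → p z ≡ true → z ≡ x ⊎ z ≡ y)
  count-two {a} p = from-enumeration (countF p) (select p) (select-injective p) (select-true p)
    (λ z ez → rank p z ez , select-rank p z ez)
    where
    from-enumeration : ∀ n (s : Fin n → Fin a) → (∀ j j′ → s j ≡ s j′ → j ≡ j′) →
      (∀ j → p (s j) ≡ true) → (∀ z → p z ≡ true → Σ (Fin n) λ j → s j ≡ z) → n ≡ 2 →
      Σ (Fin a) λ x → Σ (Fin a) λ y →
        x ≢ y × p x ≡ true × p y ≡ true × (∀ z → p z ≡ true → z ≡ x ⊎ z ≡ y)
    from-enumeration .2 s s-inj s-true s-onto refl =
      s zero , s (suc zero) , (λ q → 0≢1 (s-inj _ _ q)) , s-true zero , s-true (suc zero) , cover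
      where
      0≢1 : zero ≢ suc {1} zero
      0≢1 ()
      cover : ∀ z → p z ≡ true → z ≡ s zero ⊎ z ≡ s (suc zero)
      cover z ez with s-onto z ez
      ... | zero , q     = inj₁ (sym q)
      ... | suc zero , q = inj₂ (sym q)

  indicator : Bool → ℕ
  indicator true  = 1
  indicator false = 0

  count-as-sum : ∀ {a} (p : Fin a → Bool) → countF p ≡ sum (λ i → indicator (p i))
  count-as-sum {zero} p = refl
  count-as-sum {suc a} p with p zero
  ... | true  = cong suc (count-as-sum (λ i → p (suc i)))
  ... | false = count-as-sum (λ i → p (suc i))

  sum-const : ∀ a c → sum {a} (λ _ → c) ≡ a * c
  sum-const zero    c = refl
  sum-const (suc a) c = cong (c +_) (sum-const a c)

module Triples where

  open import Defs using (countF)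
  open Counting
  open import Data.Nat using (suc; _+_)
  open import Data.Bool using (Bool; true; false; _∨_)
  open import Data.Fin using (Fin; zero; suc; _≟_)
  open import Data.Product using (Σ; _,_)
  open import Data.Fin.Subset using (Subset; _⊆_; ∣_∣)
  open import Data.Fin.Subset.Properties using (_∈?_)
  open import Data.Vec using ([]; _∷_; lookup; tabulate)
  open import Data.Vec.Properties using (lookup∘tabulate; []=⇒lookup; lookup⇒[]=)
  open import Relation.Nullary using (Dec; yes; no; ¬_; contradiction)
  open import Relation.Nullary.Decidable using (⌊_⌋)
  open import Relation.Binary.PropositionalEquality

  ⌊⌋-sound : ∀ {P : Set} (d : Dec P) → ⌊ d ⌋ ≡ true → P
  ⌊⌋-sound (yes p) _ = p

  ⌊⌋-complete : ∀ {P : Set} (d : Dec P) → P → ⌊ d ⌋ ≡ true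
  ⌊⌋-complete (yes _) _ = refl
  ⌊⌋-complete (no ¬p) p = contradiction p ¬p

  ⌊⌋-false : ∀ {P : Set} (d : Dec P) → ¬ P → ⌊ d ⌋ ≡ false
  ⌊⌋-false (yes p) ¬p = contradiction p ¬p
  ⌊⌋-false (no _)  _  = refl

  ∈?-lookup : ∀ {v} (S : Subset v) x → ⌊ x ∈? S ⌋ ≡ lookup S x
  ∈?-lookup S x with x ∈? S
  ... | yes x∈S = sym ([]=⇒lookup x∈S)
  ... | no  x∉S with lookup S x in eq
  ...   | true  = contradiction (lookup⇒[]= x S eq) x∉S
  ...   | false = refl

  size-count : ∀ {v} (S : Subset v) → ∣ S ∣ ≡ countF (lookup S)
  size-count []          = refl
  size-count (true ∷ S)  = cong suc (size-count S)
  size-count (false ∷ S) = size-count S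

  ⊆-intro : ∀ {v} (S B : Subset v) → (∀ x → lookup S x ≡ true → lookup B x ≡ true) → S ⊆ B
  ⊆-intro S B f {x} x∈S = lookup⇒[]= x B (f x ([]=⇒lookup x∈S))

  ⊆-elim : ∀ {v} (S B : Subset v) → S ⊆ B → ∀ x → lookup S x ≡ true → lookup B x ≡ true
  ⊆-elim S B S⊆B x e = []=⇒lookup (S⊆B (lookup⇒[]= x S e))

  _==_ : ∀ {v} → Fin v → Fin v → Bool
  x == a = ⌊ x ≟ a ⌋

  ==-sound : ∀ {v} {x a : Fin v} → x == a ≡ true → x ≡ a
  ==-sound {x = x} {a} = ⌊⌋-sound (x ≟ a)

  ==-refl : ∀ {v} (x : Fin v) → x == x ≡ true
  ==-refl x = ⌊⌋-complete (x ≟ x) refl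

  ==-false : ∀ {v} {x a : Fin v} → x ≢ a → x == a ≡ false
  ==-false {x = x} {a} = ⌊⌋-false (x ≟ a)

  ==-false-sound : ∀ {v} {x a : Fin v} → x == a ≡ false → x ≢ a
  ==-false-sound {x = x} e refl = contradiction (trans (sym e) (==-refl x)) λ ()

  count-== : ∀ {v} (a : Fin v) → countF (λ x → x == a) ≡ 1
  count-== a = count-unique _ a (==-refl a) (λ j e → ==-sound e)

  corner : ∀ {X : Set} → X → X → X → Fin 3 → X
  corner a b c zero             = a
  corner a b c (suc zero)       = b
  corner a b c (suc (suc zero)) = c

  Mem : ∀ {X : Set} → X → X → X → X → Set
  Mem a b c z = Σ (Fin 3) λ k → z ≡ corner a b c k

  in-triple : ∀ {v} (a b c : Fin v) → Fin v → Bool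
  in-triple a b c x = x == a ∨ (x == b ∨ x == c)

  triple : ∀ {v} (a b c : Fin v) → Subset v
  triple a b c = tabulate (in-triple a b c)

  in-triple-sound : ∀ {v} {a b c x : Fin v} → in-triple a b c x ≡ true → Mem a b c x
  in-triple-sound {a = a} {b} {c} {x} e with x == a in ea | x == b in eb
  ... | true  | _     = zero , ==-sound ea
  ... | false | true  = suc zero , ==-sound eb
  ... | false | false = suc (suc zero) , ==-sound e

  in-triple-complete : ∀ {v} {a b c x : Fin v} → Mem a b c x → in-triple a b c x ≡ true
  in-triple-complete {a = a} (zero , refl) rewrite ==-refl a = refl
  in-triple-complete {a = a} {b} (suc zero , refl) rewrite ==-refl b with b == a
  ... | true  = refl
  ... | false = refl
  in-triple-complete {a = a} {b} {c} (suc (suc zero) , refl) rewrite ==-refl c with c == a | c == b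
  ... | true  | _     = refl
  ... | false | true  = refl
  ... | false | false = refl

  triple-sound : ∀ {v} (a b c x : Fin v) → lookup (triple a b c) x ≡ true → Mem a b c x
  triple-sound a b c x e = in-triple-sound (trans (sym (lookup∘tabulate (in-triple a b c) x)) e)

  triple-complete : ∀ {v} (a b c x : Fin v) → Mem a b c x → lookup (triple a b c) x ≡ true
  triple-complete a b c x m = trans (lookup∘tabulate (in-triple a b c) x) (in-triple-complete m)

  triple-≡-Mem : ∀ {v} {a b c a′ b′ c′ : Fin v} → triple a b c ≡ triple a′ b′ c′ →
    ∀ z → Mem a b c z → Mem a′ b′ c′ z
  triple-≡-Mem {a = a} {b} {c} {a′} {b′} {c′} e z m =
    triple-sound a′ b′ c′ z (subst (λ S → lookup S z ≡ true) e (triple-complete a b c z m))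

  triple-size : ∀ {v} (a b c : Fin v) → a ≢ b → a ≢ c → b ≢ c → ∣ triple a b c ∣ ≡ 3
  triple-size a b c a≢b a≢c b≢c = begin
    ∣ triple a b c ∣                                       ≡⟨ size-count (triple a b c) ⟩
    countF (lookup (triple a b c))                         ≡⟨ count-≗ _ _ (lookup∘tabulate (in-triple a b c)) ⟩
    countF (λ x → x == a ∨ (x == b ∨ x == c))              ≡⟨ count-∨ (_== a) _ a-only ⟩
    countF (_== a) + countF (λ x → x == b ∨ x == c)        ≡⟨ cong (countF (_== a) +_) (count-∨ (_== b) _ b-only) ⟩
    countF (_== a) + (countF (_== b) + countF (_== c))     ≡⟨ cong₂ _+_ (count-== a) (cong₂ _+_ (count-== b) (count-== c)) ⟩
    3                                                      ∎
    where
    open ≡-Reasoning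
    b-only : ∀ x → x == b ≡ true → x == c ≡ false
    b-only x e with refl ← ==-sound e = ==-false b≢c
    a-only : ∀ x → x == a ≡ true → (x == b ∨ x == c) ≡ false
    a-only x e with refl ← ==-sound e rewrite ==-false a≢b | ==-false a≢c = refl

-- The triples {x, y, x ∘ y} with x ≢ y are the blocks of a
-- Steiner triple system; any two distinct members of such a triple
-- multiply to the third one.
module SteinerQuasigroups where

  open Triples using (corner; Mem)
  open import Data.Nat using (ℕ)
  open import Data.Fin using (Fin; zero; suc; _≟_)
  open import Data.Fin.Properties using (all?)
  open import Data.Product using (_,_)
  open import Data.Unit using (tt)
  open import Relation.Nullary using (contradiction)
  open import Relation.Nullary.Decidable using (toWitness; _→-dec_; ¬?)
  open import Relation.Binary.PropositionalEquality

  record SteinerQuasigroup (X : Set) : Set where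
    field
      op   : X → X → X
      idem : ∀ x → op x x ≡ x
      comm : ∀ x y → op x y ≡ op y x
      inv  : ∀ x y → op x (op x y) ≡ y

  SQ : ℕ → Set
  SQ v = SteinerQuasigroup (Fin v)

  -- Two Steiner quasigroups are disjoint if they never agree on a pair of
  -- distinct points, i.e. if their triple systems share no block.
  Disjoint : ∀ {X : Set} → SteinerQuasigroup X → SteinerQuasigroup X → Set
  Disjoint {X} Q Q′ = ∀ (x y : X) → x ≢ y → SteinerQuasigroup.op Q x y ≢ SteinerQuasigroup.op Q′ x y

  third : Fin 3 → Fin 3 → Fin 3
  third zero             (suc zero)       = suc (suc zero)
  third zero             (suc (suc zero)) = suc zero
  third (suc zero)       zero             = suc (suc zero)
  third (suc zero)       (suc (suc zero)) = zero
  third (suc (suc zero)) zero             = suc zero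
  third (suc (suc zero)) (suc zero)       = zero
  third k                _                = k

  third-unique : ∀ k l m → k ≢ l → m ≢ k → m ≢ l → m ≡ third k l
  third-unique = toWitness {a? = all? λ k → all? λ l → all? λ m →
    ¬? (k ≟ l) →-dec ¬? (m ≟ k) →-dec ¬? (m ≟ l) →-dec (m ≟ third k l)} tt

  module Closure {X : Set} (Q : SteinerQuasigroup X) where
    open SteinerQuasigroup Q

    op-≢ˡ : ∀ {x y} → x ≢ y → op x y ≢ x
    op-≢ˡ {x} {y} x≢y e = x≢y (sym (trans (sym (inv x y)) (trans (cong (op x) e) (idem x))))

    op-≢ʳ : ∀ {x y} → x ≢ y → op x y ≢ y
    op-≢ʳ {x} {y} x≢y e = op-≢ˡ (λ q → x≢y (sym q)) (trans (comm y x) e)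

    inv-left : ∀ x y → op y (op x y) ≡ x
    inv-left x y = trans (cong (op y) (comm x y)) (inv y x)

    inv-right : ∀ x y → op (op x y) x ≡ y
    inv-right x y = trans (comm (op x y) x) (inv x y)

    corner-op : ∀ a b k l → k ≢ l →
      op (corner a b (op a b) k) (corner a b (op a b) l) ≡ corner a b (op a b) (third k l)
    corner-op a b zero             zero             k≢l = contradiction refl k≢l
    corner-op a b zero             (suc zero)       _   = refl
    corner-op a b zero             (suc (suc zero)) _   = inv a b
    corner-op a b (suc zero)       zero             _   = comm b a
    corner-op a b (suc zero)       (suc zero)       k≢l = contradiction refl k≢l
    corner-op a b (suc zero)       (suc (suc zero)) _   = inv-left a b
    corner-op a b (suc (suc zero)) zero             _   = inv-right a b
    corner-op a b (suc (suc zero)) (suc zero)       _   = trans (comm (op a b) b) (inv-left a b)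
    corner-op a b (suc (suc zero)) (suc (suc zero)) k≢l = contradiction refl k≢l

    closure-mem : ∀ {a b x y} → Mem a b (op a b) x → Mem a b (op a b) y → x ≢ y →
      Mem a b (op a b) (op x y)
    closure-mem {a} {b} (k , refl) (l , refl) x≢y =
      third k l , corner-op a b k l (λ k≡l → x≢y (cong (corner a b (op a b)) k≡l))

    closure-third : ∀ {a b x y z} → Mem a b (op a b) x → Mem a b (op a b) y → x ≢ y →
      Mem a b (op a b) z → z ≢ x → z ≢ y → z ≡ op x y
    closure-third {a} {b} (k , refl) (l , refl) x≢y (m , refl) z≢x z≢y = begin
      corner a b (op a b) m           ≡⟨ cong (corner a b (op a b)) (third-unique k l m
                                           (λ e → x≢y (cong c e)) (λ e → z≢x (cong c e)) (λ e → z≢y (cong c e))) ⟩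
      corner a b (op a b) (third k l) ≡⟨ sym (corner-op a b k l (λ e → x≢y (cong c e))) ⟩
      op (c k) (c l)                  ∎
      where
      open ≡-Reasoning
      c = corner a b (op a b)

  -- Its blocks
  -- are enumerated by their sorted representatives (x, y) with
  -- x < y < x ∘ y; every pair lies in exactly one block and, when
  -- v ≡ 2D + 1, every point lies in exactly D blocks.
  module TripleSystem {v} (Q : SQ v) where

    open SteinerQuasigroup Q
    open Closure Q
    open Counting
    open Triples
    open import Defs using (countF)
    open import Data.Nat as ℕ using (_+_; _*_)
    open import Data.Nat.Properties using (+-cancelʳ-≡; +-comm; +-identityʳ; *-cancelˡ-≡)
    open import Data.Bool using (Bool; true; false; _∧_; _∨_; not)
    open import Data.Fin using (toℕ; _<_; combine; remQuot)
    open import Data.Fin.Properties using (<-cmp; <-trans; <-asym; <⇒≢; _<?_; toℕ-injective;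
      remQuot-combine; combine-remQuot)
    import Data.Nat.Properties as ℕ
    open import Data.Fin.Subset using (Subset; ∣_∣)
    open import Data.Fin.Subset.Properties using (_⊆?_; _∈?_)
    open import Data.Vec using (lookup)
    open import Data.Vec.Properties using (lookup∘tabulate)
    open import Data.Product using (Σ; _×_; proj₁; proj₂)
    open import Data.Sum using (_⊎_; inj₁; inj₂)
    open import Relation.Nullary using (yes; no; contradiction)
    open import Relation.Nullary.Decidable using (⌊_⌋)
    open import Relation.Binary using (tri<; tri≈; tri>)
    open import Function using (_∘_)

    _<ᵇ_ : Fin v → Fin v → Bool
    x <ᵇ y = ⌊ x <? y ⌋

    <ᵇ-sound : ∀ {x y} → x <ᵇ y ≡ true → x < y
    <ᵇ-sound {x} {y} = ⌊⌋-sound (x <? y)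

    <ᵇ-complete : ∀ {x y} → x < y → x <ᵇ y ≡ true
    <ᵇ-complete {x} {y} = ⌊⌋-complete (x <? y)

    sorted : Fin v → Fin v → Bool
    sorted x y = x <ᵇ y ∧ y <ᵇ op x y

    sorted-low : ∀ {x y} → sorted x y ≡ true → x < y
    sorted-low e = <ᵇ-sound (proj₁ (∧-elim e))

    sorted-high : ∀ {x y} → sorted x y ≡ true → y < op x y
    sorted-high e = <ᵇ-sound (proj₂ (∧-elim e))

    sorted-intro : ∀ {x y} → x < y → y < op x y → sorted x y ≡ true
    sorted-intro x<y y<xy = ∧-intro (<ᵇ-complete x<y) (<ᵇ-complete y<xy)

    sorted-code : Fin (v * v) → Bool
    sorted-code e = sorted (proj₁ (remQuot {v} v e)) (proj₂ (remQuot {v} v e))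

    M : ℕ
    M = countF sorted-code

    low mid high : Fin M → Fin v
    low  j = proj₁ (remQuot {v} v (select sorted-code j))
    mid  j = proj₂ (remQuot {v} v (select sorted-code j))
    high j = op (low j) (mid j)

    low<mid : ∀ j → low j < mid j
    low<mid j = sorted-low (select-true sorted-code j)

    mid<high : ∀ j → mid j < high j
    mid<high j = sorted-high (select-true sorted-code j)

    low<high : ∀ j → low j < high j
    low<high j = <-trans (low<mid j) (mid<high j)

    sorted-code-combine : ∀ {x y} → sorted x y ≡ true → sorted-code (combine x y) ≡ true
    sorted-code-combine {x} {y} e =
      subst (λ p → sorted (proj₁ p) (proj₂ p) ≡ true) (sym (remQuot-combine x y)) e

    index : ∀ x y → sorted x y ≡ true → Fin M
    index x y e = rank sorted-code (combine x y) (sorted-code-combine e)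

    remQuot-index : ∀ x y e → remQuot {v} v (select sorted-code (index x y e)) ≡ (x , y)
    remQuot-index x y e =
      trans (cong (remQuot v) (select-rank sorted-code _ (sorted-code-combine e))) (remQuot-combine x y)

    low-index : ∀ x y e → low (index x y e) ≡ x
    low-index x y e = cong proj₁ (remQuot-index x y e)

    mid-index : ∀ x y e → mid (index x y e) ≡ y
    mid-index x y e = cong proj₂ (remQuot-index x y e)

    index-unique : ∀ j x y e → low j ≡ x → mid j ≡ y → index x y e ≡ j
    index-unique j x y e refl refl = select-injective sorted-code _ _
      (trans (select-rank sorted-code _ (sorted-code-combine e)) (combine-remQuot {v} v (select sorted-code j)))

    low-mid-injective : ∀ j j′ → low j ≡ low j′ → mid j ≡ mid j′ → j ≡ j′
    low-mid-injective j j′ el em = trans (sym (index-unique j _ _ (select-true sorted-code j) refl refl))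
      (index-unique j′ _ _ (select-true sorted-code j) (sym el) (sym em))

    block : Fin M → Subset v
    block j = triple (low j) (mid j) (high j)

    InBlock : Fin M → Fin v → Set
    InBlock j = Mem (low j) (mid j) (high j)

    block-sound : ∀ j z → lookup (block j) z ≡ true → InBlock j z
    block-sound j = triple-sound (low j) (mid j) (high j)

    block-complete : ∀ j z → InBlock j z → lookup (block j) z ≡ true
    block-complete j = triple-complete (low j) (mid j) (high j)

    block-size : ∀ j → ∣ block j ∣ ≡ 3
    block-size j = triple-size (low j) (mid j) (high j) (<⇒≢ (low<mid j)) (<⇒≢ (low<high j)) (<⇒≢ (mid<high j))

    block-shape : ∀ j → Σ (Fin v) λ a → Σ (Fin v) λ b → a ≢ b × block j ≡ triple a b (op a b)
    block-shape j = low j , mid j , <⇒≢ (low<mid j) , refl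

    -- A sorted triple a < b < c is determined by its set of members:
    -- a and c are its minimum and maximum, b is what remains.
    sorted-triple-unique : ∀ {a b c a′ b′ c′ : Fin v} → a < b → b < c → a′ < b′ → b′ < c′ →
      (∀ z → Mem a b c z → Mem a′ b′ c′ z) → (∀ z → Mem a′ b′ c′ z → Mem a b c z) → a ≡ a′ × b ≡ b′
    sorted-triple-unique {a} {b} {c} {a′} {b′} {c′} a<b b<c a′<b′ b′<c′ to from = a≡a′ , b≡b′
      where
      min≤ : ∀ {a b c z : Fin v} → a < b → b < c → Mem a b c z → toℕ a ℕ.≤ toℕ z
      min≤ a<b b<c (zero , refl)           = ℕ.≤-refl
      min≤ a<b b<c (suc zero , refl)       = ℕ.<⇒≤ a<b
      min≤ a<b b<c (suc (suc zero) , refl) = ℕ.<⇒≤ (<-trans a<b b<c)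
      ≤max : ∀ {a b c z : Fin v} → a < b → b < c → Mem a b c z → toℕ z ℕ.≤ toℕ c
      ≤max a<b b<c (zero , refl)           = ℕ.<⇒≤ (<-trans a<b b<c)
      ≤max a<b b<c (suc zero , refl)       = ℕ.<⇒≤ b<c
      ≤max a<b b<c (suc (suc zero) , refl) = ℕ.≤-refl
      a≡a′ : a ≡ a′
      a≡a′ = toℕ-injective (ℕ.≤-antisym (min≤ a<b b<c (from a′ (zero , refl))) (min≤ a′<b′ b′<c′ (to a (zero , refl))))
      c≡c′ : c ≡ c′
      c≡c′ = toℕ-injective (ℕ.≤-antisym (≤max a′<b′ b′<c′ (to c (suc (suc zero) , refl)))
                                         (≤max a<b b<c (from c′ (suc (suc zero) , refl))))
      b≡b′ : b ≡ b′
      b≡b′ with to b (suc zero , refl)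
      ... | zero , q           = contradiction (trans a≡a′ (sym q)) (<⇒≢ a<b)
      ... | suc zero , q       = q
      ... | suc (suc zero) , q = contradiction (trans q (sym c≡c′)) (<⇒≢ b<c)

    same-members-same-block : ∀ j j′ →
      (∀ z → InBlock j z → InBlock j′ z) → (∀ z → InBlock j′ z → InBlock j z) → j ≡ j′
    same-members-same-block j j′ to from with sorted-triple-unique (low<mid j) (mid<high j) (low<mid j′) (mid<high j′) to from
    ... | el , em = low-mid-injective j j′ el em

    block-injective : ∀ j j′ → block j ≡ block j′ → j ≡ j′
    block-injective j j′ e = same-members-same-block j j′ (triple-≡-Mem e) (triple-≡-Mem (sym e))

    -- Every pair p ≢ q lies in a block: sort the triple {p, q, p ∘ q}.
    module _ {p q : Fin v} (p≢q : p ≢ q) where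

      PQ : Fin v → Set
      PQ = Mem p q (op p q)

      block-of-sorted : ∀ {x y t} → PQ x → PQ y → PQ t → x < y → y < t → Σ (Fin M) λ j → InBlock j p × InBlock j q
      block-of-sorted {x} {y} {t} x∈ y∈ t∈ x<y y<t = j , contains (zero , refl) , contains (suc zero , refl)
        where
        x≢y = <⇒≢ x<y
        t≡xy : t ≡ op x y
        t≡xy = closure-third x∈ y∈ x≢y t∈ (λ e → <⇒≢ (<-trans x<y y<t) (sym e)) (λ e → <⇒≢ y<t (sym e))
        e : sorted x y ≡ true
        e = sorted-intro x<y (subst (y <_) t≡xy y<t)
        j = index x y e
        contains : ∀ {z} → PQ z → InBlock j z
        contains {z} z∈ rewrite low-index x y e | mid-index x y e with z ≟ x | z ≟ y
        ... | yes z≡x | _      = zero , z≡x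
        ... | no _    | yes z≡y = suc zero , z≡y
        ... | no z≢x  | no z≢y = suc (suc zero) , closure-third x∈ y∈ x≢y z∈ z≢x z≢y

      block-of-distinct : ∀ {x y t} → PQ x → PQ y → PQ t → x ≢ y → y ≢ t → x ≢ t →
        Σ (Fin M) λ j → InBlock j p × InBlock j q
      block-of-distinct {x} {y} {t} x∈ y∈ t∈ x≢y y≢t x≢t with <-cmp x y | <-cmp y t | <-cmp x t
      ... | tri≈ _ e _ | _ | _ = contradiction e x≢y
      ... | _ | tri≈ _ e _ | _ = contradiction e y≢t
      ... | _ | _ | tri≈ _ e _ = contradiction e x≢t
      ... | tri< x<y _ _ | tri< y<t _ _ | _            = block-of-sorted x∈ y∈ t∈ x<y y<t
      ... | tri< x<y _ _ | tri> _ _ t<y | tri< x<t _ _ = block-of-sorted x∈ t∈ y∈ x<t t<y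
      ... | tri< x<y _ _ | tri> _ _ t<y | tri> _ _ t<x = block-of-sorted t∈ x∈ y∈ t<x x<y
      ... | tri> _ _ y<x | tri< y<t _ _ | tri< x<t _ _ = block-of-sorted y∈ x∈ t∈ y<x x<t
      ... | tri> _ _ y<x | tri< y<t _ _ | tri> _ _ t<x = block-of-sorted y∈ t∈ x∈ y<t t<x
      ... | tri> _ _ y<x | tri> _ _ t<y | _            = block-of-sorted t∈ y∈ x∈ t<y y<x

      covering-block : Σ (Fin M) λ j → InBlock j p × InBlock j q
      covering-block = block-of-distinct (zero , refl) (suc zero , refl) (suc (suc zero) , refl)
        p≢q (λ e → op-≢ʳ p≢q (sym e)) (λ e → op-≢ˡ p≢q (sym e))

      -- Two blocks through p and q coincide: both consist of p, q and p ∘ q.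
      unique-block : ∀ j j′ → InBlock j p → InBlock j q → InBlock j′ p → InBlock j′ q → j ≡ j′
      unique-block j j′ p∈ q∈ p∈′ q∈′ = same-members-same-block j j′ (inside p∈ q∈ p∈′ q∈′) (inside p∈′ q∈′ p∈ q∈)
        where
        inside : ∀ {j j′} → InBlock j p → InBlock j q → InBlock j′ p → InBlock j′ q → ∀ z → InBlock j z → InBlock j′ z
        inside {j} {j′} p∈ q∈ p∈′ q∈′ z z∈ with z ≟ p | z ≟ q
        ... | yes refl | _        = p∈′
        ... | no _     | yes refl = q∈′
        ... | no z≢p   | no z≢q   =
          subst (InBlock j′) (sym (closure-third p∈ q∈ p≢q z∈ z≢p z≢q)) (closure-mem p∈′ q∈′ p≢q)

    pair-occurrence : ∀ S → ∣ S ∣ ≡ 2 → countF (λ j → ⌊ S ⊆? block j ⌋) ≡ 1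
    pair-occurrence S |S|≡2 with count-two (lookup S) (trans (sym (size-count S)) |S|≡2)
    ... | p , q , p≢q , p∈S , q∈S , S⊆pq with covering-block p≢q
    ... | j₀ , p∈ , q∈ = count-unique _ j₀ (⌊⌋-complete (S ⊆? block j₀) (⊆-intro S (block j₀) S⊆j₀)) only-j₀
      where
      S⊆j₀ : ∀ x → lookup S x ≡ true → lookup (block j₀) x ≡ true
      S⊆j₀ x x∈S with S⊆pq x x∈S
      ... | inj₁ refl = block-complete j₀ x p∈
      ... | inj₂ refl = block-complete j₀ x q∈
      only-j₀ : ∀ j → ⌊ S ⊆? block j ⌋ ≡ true → j ≡ j₀
      only-j₀ j e = unique-block p≢q j j₀ (in-j p p∈S) (in-j q q∈S) p∈ q∈
        where
        in-j : ∀ z → lookup S z ≡ true → InBlock j z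
        in-j z z∈S = block-sound j z (⊆-elim S (block j) (⌊⌋-sound (S ⊆? block j) e) z z∈S)

    degree : Fin v → ℕ
    degree x = countF (λ j → ⌊ x ∈? block j ⌋)

    -- Blocks with x in a given corner correspond to the partner y of x there.
    at-low : ∀ x → countF (λ j → x == low j) ≡ countF (sorted x)
    at-low x = count-bij _ _ (λ j _ → mid j) (λ y e → index x y e)
      (λ j e → subst (λ z → sorted z (mid j) ≡ true) (sym (==-sound e)) (select-true sorted-code j))
      (λ y e → subst (λ z → x == z ≡ true) (sym (low-index x y e)) (==-refl x))
      (λ j e → index-unique j x (mid j) _ (sym (==-sound e)) refl)
      (λ y e → mid-index x y e)

    at-mid : ∀ x → countF (λ j → x == mid j) ≡ countF (λ y → sorted y x)
    at-mid x = count-bij _ _ (λ j _ → low j) (λ y e → index y x e)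
      (λ j e → subst (λ z → sorted (low j) z ≡ true) (sym (==-sound e)) (select-true sorted-code j))
      (λ y e → subst (λ z → x == z ≡ true) (sym (mid-index y x e)) (==-refl x))
      (λ j e → index-unique j (low j) x _ refl (sym (==-sound e)))
      (λ y e → low-index y x e)

    at-high : ∀ x → countF (λ j → x == high j) ≡ countF (λ y → sorted y (op x y))
    at-high x = count-bij _ _ (λ j _ → low j) (λ y e → index y (op x y) e) to from
      (λ j e → index-unique j (low j) (op x (low j)) _ refl (mid≡ j e))
      (λ y e → low-index y (op x y) e)
      where
      mid≡ : ∀ j → x == high j ≡ true → mid j ≡ op x (low j)
      mid≡ j e = sym (trans (cong (λ z → op z (low j)) (==-sound e)) (inv-right (low j) (mid j)))
      to : ∀ j (e : x == high j ≡ true) → sorted (low j) (op x (low j)) ≡ true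
      to j e = subst (λ z → sorted (low j) z ≡ true) (mid≡ j e) (select-true sorted-code j)
      from : ∀ y (e : sorted y (op x y) ≡ true) → x == high (index y (op x y) e) ≡ true
      from y e = subst (λ z → x == z ≡ true)
        (sym (trans (cong₂ op (low-index y (op x y) e) (mid-index y (op x y) e)) (inv-left x y))) (==-refl x)

    degree-by-corner : ∀ x →
      degree x ≡ countF (sorted x) + (countF (λ y → sorted y x) + countF (λ y → sorted y (op x y)))
    degree-by-corner x =
      trans (count-≗ _ _ (λ j → trans (∈?-lookup (block j) x) (lookup∘tabulate (in-triple (low j) (mid j) (high j)) x)))
        (trans (count-∨ (λ j → x == low j) _ low-only)
          (cong₂ _+_ (at-low x) (trans (count-∨ (λ j → x == mid j) _ mid-only) (cong₂ _+_ (at-mid x) (at-high x)))))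
      where
      low-only : ∀ j → x == low j ≡ true → (x == mid j ∨ x == high j) ≡ false
      low-only j e with refl ← ==-sound e rewrite ==-false (<⇒≢ (low<mid j)) | ==-false (<⇒≢ (low<high j)) = refl
      mid-only : ∀ j → x == mid j ≡ true → x == high j ≡ false
      mid-only j e with refl ← ==-sound e = ==-false (<⇒≢ (mid<high j))

    below above : Fin v → Fin v → Bool
    below x y = y <ᵇ op x y
    above x y = op x y <ᵇ y

    -- Whatever corner x occupies, its partner y in the block lies below x ∘ y;
    -- conversely each such y arises from exactly one corner.
    corners-below : ∀ x →
      countF (sorted x) + (countF (λ y → sorted y x) + countF (λ y → sorted y (op x y))) ≡ countF (below x)
    corners-below x = trans
      (sym (trans (count-∨ (sorted x) _ disj₁) (cong (countF (sorted x) +_) (count-∨ (λ y → sorted y x) _ disj₂))))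
      (count-⇔ _ _ (λ y e → to y (∨-elim e)) from)
      where
      xy<x : ∀ {y} → sorted y (op x y) ≡ true → op x y < x
      xy<x {y} e = subst (op x y <_) (inv-left x y) (sorted-high e)
      disj₁ : ∀ y → sorted x y ≡ true → (sorted y x ∨ sorted y (op x y)) ≡ false
      disj₁ y e with sorted y x in e₂ | sorted y (op x y) in e₃
      ... | true  | _     = contradiction (sorted-low e) (<-asym (sorted-low e₂))
      ... | false | true  = contradiction (<-trans (sorted-low e) (sorted-high e)) (<-asym (xy<x e₃))
      ... | false | false = refl
      disj₂ : ∀ y → sorted y x ≡ true → sorted y (op x y) ≡ false
      disj₂ y e = ≢true λ e₃ → <-asym (subst (x <_) (comm y x) (sorted-high e)) (xy<x e₃)
      to : ∀ y → sorted x y ≡ true ⊎ (sorted y x ∨ sorted y (op x y)) ≡ true → below x y ≡ true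
      to y (inj₁ e) = proj₂ (∧-elim e)
      to y (inj₂ e) with ∨-elim e
      ... | inj₁ e₂ = <ᵇ-complete (<-trans (sorted-low e₂) (subst (x <_) (comm y x) (sorted-high e₂)))
      ... | inj₂ e₃ = proj₁ (∧-elim e₃)
      from : ∀ y → below x y ≡ true → (sorted x y ∨ (sorted y x ∨ sorted y (op x y))) ≡ true
      from y e with <ᵇ-sound e | <-cmp x y
      ... | y<xy | tri< x<y _ _ = ∨-introˡ _ (sorted-intro x<y y<xy)
      ... | y<xy | tri≈ _ refl _ = contradiction (idem y) (<⇒≢ y<xy ∘ sym)
      ... | y<xy | tri> _ _ y<x with <-cmp x (op x y)
      ...   | tri< x<xy _ _ = ∨-introʳ (sorted x y) (∨-introˡ (sorted y (op x y)) (sorted-intro y<x (subst (x <_) (comm x y) x<xy)))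
      ...   | tri≈ _ x≡xy _ = contradiction (sym x≡xy) (op-≢ˡ (λ x≡y → <⇒≢ y<x (sym x≡y)))
      ...   | tri> _ _ xy<x = ∨-introʳ (sorted x y) (∨-introʳ (sorted y x) (sorted-intro y<xy (subst (op x y <_) (sym (inv-left x y)) xy<x)))

    -- y ↦ x ∘ y exchanges the partners below and above.
    below≡above : ∀ x → countF (below x) ≡ countF (above x)
    below≡above x = count-bij _ _ (λ y _ → op x y) (λ y _ → op x y) flip flip′ (λ y _ → inv x y) (λ y _ → inv x y)
      where
      flip : ∀ y → below x y ≡ true → above x (op x y) ≡ true
      flip y e = subst (λ z → z <ᵇ op x y ≡ true) (sym (inv x y)) e
      flip′ : ∀ y → above x y ≡ true → below x (op x y) ≡ true
      flip′ y e = subst (λ z → op x y <ᵇ z ≡ true) (sym (inv x y)) e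

    below+above : ∀ x → countF (below x) + countF (above x) ≡ countF (λ y → not (y == x))
    below+above x = trans (sym (count-∨ (below x) (above x) disj)) (count-⇔ _ _ to from)
      where
      disj : ∀ y → below x y ≡ true → above x y ≡ false
      disj y e = ≢true λ e′ → <-asym (<ᵇ-sound e) (<ᵇ-sound e′)
      to : ∀ y → (below x y ∨ above x y) ≡ true → not (y == x) ≡ true
      to y e with y == x in eq
      ... | false = refl
      ... | true with refl ← ==-sound eq with ∨-elim e
      ...   | inj₁ e′ = contradiction (sym (idem y)) (<⇒≢ (<ᵇ-sound e′))
      ...   | inj₂ e′ = contradiction (idem y) (<⇒≢ (<ᵇ-sound e′))
      from : ∀ y → not (y == x) ≡ true → (below x y ∨ above x y) ≡ true
      from y e with <-cmp y (op x y)
      ... | tri< y<xy _ _ = ∨-introˡ _ (<ᵇ-complete y<xy)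
      ... | tri≈ _ y≡xy _ = contradiction (sym y≡xy) (op-≢ʳ λ x≡y → ==-false-sound (not-true e) (sym x≡y))
      ... | tri> _ _ xy<y = ∨-introʳ _ (<ᵇ-complete xy<y)

    degree-twice : ∀ x → degree x + degree x + 1 ≡ v
    degree-twice x = begin
      degree x + degree x + 1                                    ≡⟨ cong (λ d → d + d + 1) (trans (degree-by-corner x) (corners-below x)) ⟩
      countF (below x) + countF (below x) + 1                    ≡⟨ cong (λ c → countF (below x) + c + 1) (below≡above x) ⟩
      countF (below x) + countF (above x) + 1                    ≡⟨ cong (_+ 1) (below+above x) ⟩
      countF (λ y → not (y == x)) + 1                            ≡⟨ +-comm _ 1 ⟩
      1 + countF (λ y → not (y == x))                            ≡⟨ cong (_+ countF (λ y → not (y == x))) (sym (count-== x)) ⟩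
      countF (_== x) + countF (λ y → not (y == x))               ≡⟨ count-complement (_== x) ⟩
      v                                                          ∎
      where open ≡-Reasoning

    double-injective : ∀ k D → k + k ≡ D + D → k ≡ D
    double-injective k D e = *-cancelˡ-≡ k D 2
      (trans (cong (k +_) (+-identityʳ k)) (trans e (sym (cong (D +_) (+-identityʳ D)))))

    degree-≡ : ∀ D → D + D + 1 ≡ v → ∀ x → degree x ≡ D
    degree-≡ D v≡ x = double-injective _ D (+-cancelʳ-≡ 1 _ _ (trans (degree-twice x) (sym v≡)))

    -- Double counting point-block incidences: v * D ≡ M * 3.
    volume : ∀ D → D + D + 1 ≡ v → M * 3 ≡ v * D
    volume D v≡ = sym (begin
      v * D                                                   ≡⟨ sum-const v D ⟨
      sum {v} (λ _ → D)                                       ≡⟨ sum-cong-≗ degree-as-sum ⟩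
      sum (λ x → sum (λ j → indicator ⌊ x ∈? block j ⌋))      ≡⟨ ∑-comm (λ x j → indicator ⌊ x ∈? block j ⌋) ⟩
      sum (λ j → sum (λ x → indicator ⌊ x ∈? block j ⌋))      ≡⟨ sum-cong-≗ size-as-sum ⟩
      sum {M} (λ _ → 3)                                       ≡⟨ sum-const M 3 ⟩
      M * 3                                                   ∎)
      where
      open ≡-Reasoning
      degree-as-sum : ∀ x → D ≡ sum (λ j → indicator ⌊ x ∈? block j ⌋)
      degree-as-sum x = trans (sym (degree-≡ D v≡ x)) (count-as-sum (λ j → ⌊ x ∈? block j ⌋))
      size-as-sum : ∀ j → sum (λ x → indicator ⌊ x ∈? block j ⌋) ≡ 3
      size-as-sum j = trans (sym (count-as-sum (λ x → ⌊ x ∈? block j ⌋)))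
        (trans (count-≗ _ _ (∈?-lookup (block j))) (trans (sym (size-count (block j))) (block-size j)))

module TradeFromQuasigroups where

  open import Defs using (Trade; IsSteiner; IsHomogeneous; countF)
  open Triples
  open SteinerQuasigroups
  open SteinerQuasigroup using (op)
  open import Data.Nat using (ℕ; _+_; _*_; _∸_; _/_; _<_; s≤s; z≤n)
  open import Data.Nat.Properties using (≤-reflexive; m+n∸n≡m; *-distribˡ-+; *-comm; +-identityʳ)
  open import Data.Nat.DivMod using (m*n/n≡m)
  open import Data.Fin using (Fin; zero; suc)
  open import Data.Fin.Subset using (Subset; ∣_∣)
  open import Data.Fin.Subset.Properties using (_⊆?_; _∈?_)
  open import Data.Product using (Σ; _×_; _,_)
  open import Relation.Nullary.Decidable using (⌊_⌋)
  open import Relation.Binary.PropositionalEquality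

  -- A common block {a, b, a ∘ b} = {a′, b′, a′ ∘′ b′} would force a ∘ b ≡ a ∘′ b.
  no-common-block : ∀ {v} (Q Q′ : SQ v) → Disjoint Q Q′ →
    ∀ {a b a′ b′} → a ≢ b → a′ ≢ b′ → triple a b (op Q a b) ≢ triple a′ b′ (op Q′ a′ b′)
  no-common-block Q Q′ disj {a} {b} {a′} {b′} a≢b a′≢b′ e = disj a b a≢b
    (Closure.closure-third Q′ (member (zero , refl)) (member (suc zero , refl)) a≢b
      (member (suc (suc zero) , refl)) (Closure.op-≢ˡ Q a≢b) (Closure.op-≢ʳ Q a≢b))
    where
    member : ∀ {z} → Mem a b (op Q a b) z → Mem a′ b′ (op Q′ a′ b′) z
    member = triple-≡-Mem e _

  -- The properties of a triple system that the trade records, with the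
  -- number m of blocks as a parameter so that it can be rewritten.
  record TripleSystemData (v m D : ℕ) (Q : SQ v) : Set where
    field
      block     : Fin m → Subset v
      size      : ∀ j → ∣ block j ∣ ≡ 3
      injective : ∀ j j′ → block j ≡ block j′ → j ≡ j′
      pairs     : ∀ S → ∣ S ∣ ≡ 2 → countF (λ j → ⌊ S ⊆? block j ⌋) ≡ 1
      degree    : ∀ x → countF (λ j → ⌊ x ∈? block j ⌋) ≡ D
      shape     : ∀ j → Σ (Fin v) λ a → Σ (Fin v) λ b → a ≢ b × block j ≡ triple a b (op Q a b)

  triple-system : ∀ {v} D (Q : SQ v) → D + D + 1 ≡ v → TripleSystemData v (TripleSystem.M Q) D Q
  triple-system D Q v≡ = record
    { block = S.block ; size = S.block-size ; injective = S.block-injective ; pairs = S.pair-occurrence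
    ; degree = S.degree-≡ D v≡ ; shape = S.block-shape }
    where module S = TripleSystem Q

  v∸1≡ : ∀ v D → D + D + 1 ≡ v → v ∸ 1 ≡ D + D
  v∸1≡ v D v≡ = trans (cong (_∸ 1) (sym v≡)) (m+n∸n≡m (D + D) 1)

  replication≡ : ∀ v D → D + D + 1 ≡ v → (v ∸ 1) / 2 ≡ D
  replication≡ v D v≡ = trans (cong (_/ 2) v∸1≡D*2) (m*n/n≡m D 2)
    where
    v∸1≡D*2 : v ∸ 1 ≡ D * 2
    v∸1≡D*2 = trans (v∸1≡ v D v≡) (trans (cong (D +_) (sym (+-identityʳ D))) (*-comm 2 D))

  volume≡ : ∀ v D M → D + D + 1 ≡ v → M * 3 ≡ v * D → (v * (v ∸ 1)) / 6 ≡ M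
  volume≡ v D M v≡ M*3≡ = trans (cong (_/ 6) v[v∸1]≡) (m*n/n≡m M 6)
    where
    v[v∸1]≡ : v * (v ∸ 1) ≡ M * 6
    v[v∸1]≡ = begin
      v * (v ∸ 1)       ≡⟨ cong (v *_) (v∸1≡ v D v≡) ⟩
      v * (D + D)       ≡⟨ *-distribˡ-+ v D D ⟩
      v * D + v * D     ≡⟨ cong₂ _+_ M*3≡ M*3≡ ⟨
      M * 3 + M * 3     ≡⟨ *-distribˡ-+ M 3 3 ⟨
      M * 6             ∎
      where open ≡-Reasoning

  trade-from-quasigroups : ∀ v D m → 3 < v → D + D + 1 ≡ v → (Q : Fin 3 → SQ v) →
    (∀ i i′ → i ≢ i′ → Disjoint (Q i) (Q i′)) → (∀ i → TripleSystem.M (Q i) ≡ m) →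
    Σ (Trade 3 v 3 2 m) (λ T → IsSteiner T × IsHomogeneous D T)
  trade-from-quasigroups v D m 3<v v≡ Q disjoint M≡m = T , steiner , homogeneous
    where
    system : ∀ i → TripleSystemData v m D (Q i)
    system i = subst (λ k → TripleSystemData v k D (Q i)) (M≡m i) (triple-system D (Q i) v≡)
    module Sys i = TripleSystemData (system i)
    blocks-disjoint : ∀ i i′ j j′ → i ≢ i′ → Sys.block i j ≢ Sys.block i′ j′
    blocks-disjoint i i′ j j′ i≢i′ e with Sys.shape i j | Sys.shape i′ j′
    ... | a , b , a≢b , ea | a′ , b′ , a′≢b′ , ea′ =
      no-common-block (Q i) (Q i′) (disjoint i i′ i≢i′) a≢b a′≢b′ (trans (sym ea) (trans e ea′))
    T : Trade 3 v 3 2 m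
    T = record
      { t<k        = s≤s (s≤s (s≤s z≤n))
      ; k<v        = 3<v
      ; blocks     = Sys.block
      ; block-size = Sys.size
      ; distinct   = Sys.injective
      ; disjoint   = blocks-disjoint
      ; balanced   = λ S |S| i i′ → trans (Sys.pairs i S |S|) (sym (Sys.pairs i′ S |S|))
      }
    steiner : IsSteiner T
    steiner S |S| _ i = ≤-reflexive (Sys.pairs i S |S|)
    homogeneous : IsHomogeneous D T
    homogeneous x i = Sys.degree i x

  HomogeneousSteinerTrade : ℕ → Set
  HomogeneousSteinerTrade v =
    Σ (Trade 3 v 3 2 ((v * (v ∸ 1)) / 6)) (λ T → IsSteiner T × IsHomogeneous ((v ∸ 1) / 2) T)

  steiner-trade : ∀ v D → 3 < v → D + D + 1 ≡ v → (Q : Fin 3 → SQ v) →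
    (∀ i i′ → i ≢ i′ → Disjoint (Q i) (Q i′)) → HomogeneousSteinerTrade v
  steiner-trade v D 3<v v≡ Q disjoint =
    subst (λ d → Σ (Trade 3 v 3 2 ((v * (v ∸ 1)) / 6)) (λ T → IsSteiner T × IsHomogeneous d T))
      (sym (replication≡ v D v≡))
      (trade-from-quasigroups v D _ 3<v v≡ Q disjoint (λ i → sym (volume≡ v D _ v≡ (TripleSystem.volume (Q i) D v≡))))

module Transport where

  open SteinerQuasigroups
  open import Function using (_↔_; Inverse)
  open import Relation.Binary.PropositionalEquality

  module _ {X Y : Set} (e : X ↔ Y) where
    open Inverse e

    transport : SteinerQuasigroup X → SteinerQuasigroup Y
    transport Q = record
      { op   = λ i j → to (op (from i) (from j))
      ; idem = λ i → trans (cong to (idem (from i))) (strictlyInverseˡ i)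
      ; comm = λ i j → cong to (comm (from i) (from j))
      ; inv  = λ i j → trans (cong (λ z → to (op (from i) z)) (strictlyInverseʳ _))
                       (trans (cong to (inv (from i) (from j))) (strictlyInverseˡ j))
      }
      where open SteinerQuasigroup Q

    transport-disjoint : (Q Q′ : SteinerQuasigroup X) → Disjoint Q Q′ → Disjoint (transport Q) (transport Q′)
    transport-disjoint Q Q′ disj i j i≢j eq = disj (from i) (from j)
      (λ q → i≢j (trans (sym (strictlyInverseˡ i)) (trans (cong to q) (strictlyInverseˡ j))))
      (trans (sym (strictlyInverseʳ _)) (trans (cong from eq) (strictlyInverseʳ _)))

  conjugates-disjoint : ∀ {X : Set} (Q : SteinerQuasigroup X) (α β : X ↔ X) →
    (let open SteinerQuasigroup Q; γ = λ x → Inverse.from β (Inverse.to α x) in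
     ∀ x y → x ≢ y → γ (op x y) ≢ op (γ x) (γ y)) →
    Disjoint (transport α Q) (transport β Q)
  conjugates-disjoint Q α β twisted x y x≢y eq =
    twisted (α.from x) (α.from y) (λ q → x≢y (trans (sym (α.strictlyInverseˡ x)) (trans (cong α.to q) (α.strictlyInverseˡ y))))
      (trans (cong β.from eq) (trans (β.strictlyInverseʳ _)
        (cong₂ op (cong β.from (sym (α.strictlyInverseˡ x))) (cong β.from (sym (α.strictlyInverseˡ y))))))
    where
    open SteinerQuasigroup Q
    module α = Inverse α
    module β = Inverse β

module Cyclic (m′ : ℕ) where

  open import Data.Nat using (zero; suc; _+_; _*_; _≤_; _<_; _∸_; _%_)
  open import Data.Nat.Properties using (+-comm; +-assoc; +-identityʳ; m+[n∸m]≡n; <⇒≤; m∸n+n≡m; >⇒≢)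
  open import Data.Nat.DivMod
  open import Data.Fin using (Fin; zero; toℕ; fromℕ<)
  open import Data.Fin.Properties using (toℕ-fromℕ<; toℕ-injective; toℕ<n)
  open import Relation.Binary.PropositionalEquality

  m : ℕ
  m = suc m′

  Z : Set
  Z = Fin m

  mk : ℕ → Z
  mk a = fromℕ< (m%n<n a m)

  toℕ-mk : ∀ a → toℕ (mk a) ≡ a % m
  toℕ-mk a = toℕ-fromℕ< (m%n<n a m)

  toℕ-mk-< : ∀ a → a < m → toℕ (mk a) ≡ a
  toℕ-mk-< a a<m = trans (toℕ-mk a) (m<n⇒m%n≡m a<m)

  mk-toℕ : ∀ (z : Z) → mk (toℕ z) ≡ z
  mk-toℕ z = toℕ-injective (toℕ-mk-< (toℕ z) (toℕ<n z))

  mk-≡ : ∀ a b → a % m ≡ b % m → mk a ≡ mk b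
  mk-≡ a b e = toℕ-injective (trans (toℕ-mk a) (trans e (sym (toℕ-mk b))))

  mk-≡⁻¹ : ∀ {a b} → mk a ≡ mk b → a % m ≡ b % m
  mk-≡⁻¹ {a} {b} e = trans (sym (toℕ-mk a)) (trans (cong toℕ e) (toℕ-mk b))

  mk-%-* : ∀ a c → mk (a % m * c) ≡ mk (a * c)
  mk-%-* a c = mk-≡ (a % m * c) (a * c) (begin
    (a % m * c) % m           ≡⟨ %-distribˡ-* (a % m) c m ⟩
    (a % m % m * (c % m)) % m ≡⟨ cong (λ x → (x * (c % m)) % m) (m%n%n≡m%n a m) ⟩
    (a % m * (c % m)) % m     ≡⟨ %-distribˡ-* a c m ⟨
    (a * c) % m               ∎)
    where open ≡-Reasoning

  %-wrap : ∀ x → m ≤ x → x ∸ m < m → x % m ≡ x ∸ m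
  %-wrap x m≤x x∸m<m = trans (cong (_% m) (sym (m∸n+n≡m m≤x))) (trans ([m+n]%n≡m%n (x ∸ m) m) (m<n⇒m%n≡m x∸m<m))

  infixl 6 _⊕_ _⊖_

  _⊕_ : Z → Z → Z
  a ⊕ b = mk (toℕ a + toℕ b)

  neg : Z → Z
  neg a = mk (m ∸ toℕ a)

  _⊖_ : Z → Z → Z
  a ⊖ b = a ⊕ neg b

  𝟎 : Z
  𝟎 = zero

  -- mk is additive; with it the group laws reduce to arithmetic in ℕ.
  mk-+ : ∀ a b → mk a ⊕ mk b ≡ mk (a + b)
  mk-+ a b = mk-≡ (toℕ (mk a) + toℕ (mk b)) (a + b)
    (trans (cong₂ (λ x y → (x + y) % m) (toℕ-mk a) (toℕ-mk b)) (sym (%-distribˡ-+ a b m)))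

  ⊕-comm : ∀ a b → a ⊕ b ≡ b ⊕ a
  ⊕-comm a b = cong mk (+-comm (toℕ a) (toℕ b))

  ⊕-assoc : ∀ a b c → (a ⊕ b) ⊕ c ≡ a ⊕ (b ⊕ c)
  ⊕-assoc a b c = begin
    mk (A + B) ⊕ c          ≡⟨ cong (mk (A + B) ⊕_) (mk-toℕ c) ⟨
    mk (A + B) ⊕ mk C       ≡⟨ mk-+ (A + B) C ⟩
    mk (A + B + C)          ≡⟨ cong mk (+-assoc A B C) ⟩
    mk (A + (B + C))        ≡⟨ mk-+ A (B + C) ⟨
    mk A ⊕ mk (B + C)       ≡⟨ cong (_⊕ (b ⊕ c)) (mk-toℕ a) ⟩
    a ⊕ (b ⊕ c)             ∎
    where
    open ≡-Reasoning
    A = toℕ a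
    B = toℕ b
    C = toℕ c

  ⊕-identityʳ : ∀ a → a ⊕ 𝟎 ≡ a
  ⊕-identityʳ a = trans (cong mk (+-identityʳ (toℕ a))) (mk-toℕ a)

  ⊕-inverseʳ : ∀ a → a ⊕ neg a ≡ 𝟎
  ⊕-inverseʳ a = begin
    a ⊕ neg a                  ≡⟨ cong (_⊕ neg a) (mk-toℕ a) ⟨
    mk (toℕ a) ⊕ mk (m ∸ toℕ a) ≡⟨ mk-+ (toℕ a) (m ∸ toℕ a) ⟩
    mk (toℕ a + (m ∸ toℕ a))    ≡⟨ cong mk (m+[n∸m]≡n (<⇒≤ (toℕ<n a))) ⟩
    mk m                        ≡⟨ toℕ-injective (trans (toℕ-mk m) (n%n≡0 m)) ⟩
    𝟎                           ∎
    where open ≡-Reasoning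

  ⊕-cancelʳ : ∀ {a b} c → a ⊕ c ≡ b ⊕ c → a ≡ b
  ⊕-cancelʳ {a} {b} c e = begin
    a                  ≡⟨ ⊕-identityʳ a ⟨
    a ⊕ 𝟎              ≡⟨ cong (a ⊕_) (⊕-inverseʳ c) ⟨
    a ⊕ (c ⊕ neg c)    ≡⟨ ⊕-assoc a c (neg c) ⟨
    (a ⊕ c) ⊕ neg c    ≡⟨ cong (_⊕ neg c) e ⟩
    (b ⊕ c) ⊕ neg c    ≡⟨ ⊕-assoc b c (neg c) ⟩
    b ⊕ (c ⊕ neg c)    ≡⟨ cong (b ⊕_) (⊕-inverseʳ c) ⟩
    b ⊕ 𝟎              ≡⟨ ⊕-identityʳ b ⟩
    b                  ∎
    where open ≡-Reasoning

  ⊕-cancelˡ : ∀ {a b} c → c ⊕ a ≡ c ⊕ b → a ≡ b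
  ⊕-cancelˡ {a} {b} c e = ⊕-cancelʳ c (trans (⊕-comm a c) (trans e (⊕-comm c b)))

  ⊖-⊕ : ∀ a b → (a ⊖ b) ⊕ b ≡ a
  ⊖-⊕ a b = trans (⊕-assoc a (neg b) b) (trans (cong (a ⊕_) (trans (⊕-comm (neg b) b) (⊕-inverseʳ b))) (⊕-identityʳ a))

  ⊕-⊖ : ∀ a b → (a ⊕ b) ⊖ b ≡ a
  ⊕-⊖ a b = trans (⊕-assoc a b (neg b)) (trans (cong (a ⊕_) (⊕-inverseʳ b)) (⊕-identityʳ a))

  ⊕-⊖ˡ : ∀ a b → (a ⊕ b) ⊖ a ≡ b
  ⊕-⊖ˡ a b = trans (cong (_⊖ a) (⊕-comm a b)) (⊕-⊖ b a)

  ⊕-⊖-cancel : ∀ a b → a ⊕ (b ⊖ a) ≡ b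
  ⊕-⊖-cancel a b = trans (⊕-comm a (b ⊖ a)) (⊖-⊕ b a)

  ⊕≡⇒≡⊖ : ∀ {x y z} → x ⊕ y ≡ z → x ≡ z ⊖ y
  ⊕≡⇒≡⊖ {x} {y} e = trans (sym (⊕-⊖ x y)) (cong (_⊖ y) e)

  ⊖-involutive : ∀ a b → a ⊖ (a ⊖ b) ≡ b
  ⊖-involutive a b = sym (⊕≡⇒≡⊖ (trans (⊕-comm b (a ⊖ b)) (⊖-⊕ a b)))

  ⊖≡⊖⇒⊕≡⊕ : ∀ a b c d → a ⊖ b ≡ c ⊖ d → a ⊕ d ≡ c ⊕ b
  ⊖≡⊖⇒⊕≡⊕ a b c d e = begin
    a ⊕ d                ≡⟨ cong (_⊕ d) (⊖-⊕ a b) ⟨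
    ((a ⊖ b) ⊕ b) ⊕ d    ≡⟨ cong (λ z → (z ⊕ b) ⊕ d) e ⟩
    ((c ⊖ d) ⊕ b) ⊕ d    ≡⟨ ⊕-assoc (c ⊖ d) b d ⟩
    (c ⊖ d) ⊕ (b ⊕ d)    ≡⟨ cong ((c ⊖ d) ⊕_) (⊕-comm b d) ⟩
    (c ⊖ d) ⊕ (d ⊕ b)    ≡⟨ ⊕-assoc (c ⊖ d) d b ⟨
    ((c ⊖ d) ⊕ d) ⊕ b    ≡⟨ cong (_⊕ b) (⊖-⊕ c d) ⟩
    c ⊕ b                ∎
    where open ≡-Reasoning

  ⊕-interchange : ∀ a b c d → (a ⊕ b) ⊕ (c ⊕ d) ≡ (a ⊕ c) ⊕ (b ⊕ d)
  ⊕-interchange a b c d = begin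
    (a ⊕ b) ⊕ (c ⊕ d)    ≡⟨ ⊕-assoc a b (c ⊕ d) ⟩
    a ⊕ (b ⊕ (c ⊕ d))    ≡⟨ cong (a ⊕_) (⊕-assoc b c d) ⟨
    a ⊕ ((b ⊕ c) ⊕ d)    ≡⟨ cong (λ z → a ⊕ (z ⊕ d)) (⊕-comm b c) ⟩
    a ⊕ ((c ⊕ b) ⊕ d)    ≡⟨ cong (a ⊕_) (⊕-assoc c b d) ⟩
    a ⊕ (c ⊕ (b ⊕ d))    ≡⟨ ⊕-assoc a c (b ⊕ d) ⟨
    (a ⊕ c) ⊕ (b ⊕ d)    ∎
    where open ≡-Reasoning

  mk-+-≢ : ∀ s d → 0 < d → d < m → mk (s + d) ≢ mk s
  mk-+-≢ s d 0<d d<m e = >⇒≢ 0<d (trans (sym (m<n⇒m%n≡m d<m)) (mk-≡⁻¹ {d} {0} mk-d≡0))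
    where
    mk-d≡0 : mk d ≡ mk 0
    mk-d≡0 = ⊕-cancelˡ (mk s) (trans (mk-+ s d) (trans e (sym (⊕-identityʳ (mk s)))))

-- The key property is that for c ≢ c′ the
-- differences shift c i − shift c′ i at two distinct levels differ by 1 or 2,
-- hence are distinct modulo any m ≥ 3.
module Shifts where

  open import Data.Nat using (ℕ; _+_; _≤_; _<_; _≡ᵇ_; s≤s; z≤n)
  open import Data.Nat.Properties using (≡ᵇ⇒≡; <-≤-trans)
  open import Data.Bool using (Bool; T; _∨_)
  open import Data.Bool.Properties using (T-∨)
  open import Data.Fin using (Fin; zero; suc; _≟_)
  open import Data.Fin.Properties using (all?)
  open import Data.Sum using (_⊎_; inj₁; inj₂)
  open import Data.Unit using (tt)
  open import Function using (Equivalence; _∘_)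
  open import Relation.Nullary.Decidable using (toWitness; _→-dec_; ¬?; T?)
  open import Relation.Binary.PropositionalEquality

  shift : Fin 3 → Fin 3 → ℕ
  shift zero             _                = 0
  shift (suc zero)       zero             = 0
  shift (suc zero)       (suc zero)       = 1
  shift (suc zero)       (suc (suc zero)) = 2
  shift (suc (suc zero)) zero             = 0
  shift (suc (suc zero)) (suc zero)       = 2
  shift (suc (suc zero)) (suc (suc zero)) = 1

  split : ∀ x y → T (x ∨ y) → T x ⊎ T y
  split x y = Equivalence.to (T-∨ {x} {y})

  0<1 : 0 < 1
  0<1 = s≤s z≤n

  0<2 : 0 < 2
  0<2 = s≤s z≤n

  1<3 : 1 < 3
  1<3 = s≤s (s≤s z≤n)

  2<3 : 2 < 3
  2<3 = s≤s (s≤s (s≤s z≤n))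

  close : ℕ → ℕ → Bool
  close s t = (s + 1 ≡ᵇ t) ∨ (s + 2 ≡ᵇ t) ∨ (t + 1 ≡ᵇ s) ∨ (t + 2 ≡ᵇ s)

  shifts-close : ∀ c c′ → c ≢ c′ → ∀ i j → i ≢ j →
    T (close (shift c i + shift c′ j) (shift c j + shift c′ i))
  shifts-close = toWitness {a? = all? λ c → all? λ c′ → ¬? (c ≟ c′) →-dec all? λ i → all? λ j → ¬? (i ≟ j) →-dec
    T? (close (shift c i + shift c′ j) (shift c j + shift c′ i))} tt

  module InCyclic (m′ : ℕ) (3≤m : 3 ≤ Cyclic.m m′) where
    open Cyclic m′

    apart : ∀ s d t → 0 < d → d < 3 → T (s + d ≡ᵇ t) → mk t ≢ mk s
    apart s d t 0<d d<3 e rewrite sym (≡ᵇ⇒≡ (s + d) t e) = mk-+-≢ s d 0<d (<-≤-trans d<3 3≤m)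

    close-≢ : ∀ s t → T (close s t) → mk s ≢ mk t
    close-≢ s t c with split (s + 1 ≡ᵇ t) _ c
    ... | inj₁ e = apart s 1 t 0<1 1<3 e ∘ sym
    ... | inj₂ c₁ with split (s + 2 ≡ᵇ t) _ c₁
    ...   | inj₁ e = apart s 2 t 0<2 2<3 e ∘ sym
    ...   | inj₂ c₂ with split (t + 1 ≡ᵇ s) _ c₂
    ...     | inj₁ e = apart t 1 s 0<1 1<3 e
    ...     | inj₂ e = apart t 2 s 0<2 2<3 e

    U : Fin 3 → Fin 3 → Z
    U c i = mk (shift c i)

    shift-differences-distinct : ∀ c c′ → c ≢ c′ → ∀ i j → i ≢ j → U c i ⊖ U c′ i ≢ U c j ⊖ U c′ j
    shift-differences-distinct c c′ c≢c′ i j i≢j e =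
      close-≢ (shift c i + shift c′ j) (shift c j + shift c′ i) (shifts-close c c′ c≢c′ i j i≢j)
        (trans (sym (mk-+ (shift c i) (shift c′ j)))
          (trans (⊖≡⊖⇒⊕≡⊕ (U c i) (U c′ i) (U c j) (U c′ j) e) (mk-+ (shift c j) (shift c′ i))))

-- The Bose construction of a Steiner quasigroup on ℤ_m × {0, 1, 2} for odd
-- m = 2k + 1 (so v = 3m ≡ 3 mod 6).  With the idempotent commutative
-- quasigroup x ∘ y = (x + y)/2 on ℤ_m, the blocks are
--   {(x,0), (x,1), (x,2)}  and  {(x,i), (y,i), (x ∘ y, i+1)}  for x ≢ y.
-- Translating each level i by an amount d i gives an isomorphic system; if
-- the d i are pairwise distinct, no pair of points has the same third point
-- in both systems.
module Bose (k : ℕ) where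

  open import Data.Nat using (suc; _+_; _*_; _%_)
  open import Data.Nat.DivMod using ([m+kn]%n≡m%n)
  open import Data.Nat.Tactic.RingSolver using (solve-∀)
  open import Data.Fin using (Fin; toℕ; _≟_)
  open import Data.Fin.Patterns using (0F; 1F; 2F)
  open import Function using (_∘_; _↔_; mk↔ₛ′)
  open import Data.Product using (_×_; _,_; proj₁; proj₂)
  open import Relation.Nullary using (yes; no; contradiction)
  open import Relation.Binary.PropositionalEquality
  open SteinerQuasigroups using (SteinerQuasigroup)
  open Cyclic (k + k) public

  -- Halving in ℤ_(2k+1): multiplication by k + 1.
  half : Z → Z
  half a = mk (toℕ a * suc k)

  -- The ring identities behind halving: 2(k + 1) ≡ m + 1.
  half-double-toℕ : ∀ A k → A * suc k + A * suc k ≡ A + A * suc (k + k)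
  half-double-toℕ = solve-∀

  double-half-toℕ : ∀ A k → (A + A) * suc k ≡ A + A * suc (k + k)
  double-half-toℕ = solve-∀

  double-half : ∀ a → half a ⊕ half a ≡ a
  double-half a = begin
    half a ⊕ half a                  ≡⟨ mk-+ (toℕ a * suc k) (toℕ a * suc k) ⟩
    mk (toℕ a * suc k + toℕ a * suc k) ≡⟨ cong mk (half-double-toℕ (toℕ a) k) ⟩
    mk (toℕ a + toℕ a * m)           ≡⟨ mk-≡ (toℕ a + toℕ a * m) (toℕ a) ([m+kn]%n≡m%n (toℕ a) (toℕ a) m) ⟩
    mk (toℕ a)                       ≡⟨ mk-toℕ a ⟩
    a                                ∎
    where open ≡-Reasoning

  half-double : ∀ a → half (a ⊕ a) ≡ a
  half-double a = begin
    mk (toℕ (a ⊕ a) * suc k)         ≡⟨ cong (λ x → mk (x * suc k)) (toℕ-mk (toℕ a + toℕ a)) ⟩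
    mk ((toℕ a + toℕ a) % m * suc k) ≡⟨ mk-%-* (toℕ a + toℕ a) (suc k) ⟩
    mk ((toℕ a + toℕ a) * suc k)     ≡⟨ cong mk (double-half-toℕ (toℕ a) k) ⟩
    mk (toℕ a + toℕ a * m)           ≡⟨ mk-≡ (toℕ a + toℕ a * m) (toℕ a) ([m+kn]%n≡m%n (toℕ a) (toℕ a) m) ⟩
    mk (toℕ a)                       ≡⟨ mk-toℕ a ⟩
    a                                ∎
    where open ≡-Reasoning

  double-injective : ∀ {a b} → a ⊕ a ≡ b ⊕ b → a ≡ b
  double-injective {a} {b} e = trans (sym (half-double a)) (trans (cong half e) (half-double b))

  half-shift : ∀ s d → half (s ⊕ (d ⊕ d)) ≡ half s ⊕ d
  half-shift s d = double-injective (begin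
    half (s ⊕ (d ⊕ d)) ⊕ half (s ⊕ (d ⊕ d)) ≡⟨ double-half _ ⟩
    s ⊕ (d ⊕ d)                             ≡⟨ cong (_⊕ (d ⊕ d)) (double-half s) ⟨
    (half s ⊕ half s) ⊕ (d ⊕ d)             ≡⟨ ⊕-interchange (half s) (half s) d d ⟩
    (half s ⊕ d) ⊕ (half s ⊕ d)             ∎)
    where open ≡-Reasoning

  Point : Set
  Point = Z × Fin 3

  within : Z → Z → Fin 3 → Fin 3 → Point
  within x y i i′ with x ≟ y
  ... | yes _ = x , i
  ... | no  _ = half (x ⊕ y) , i′

  -- The product of (x, i) and (y, i′) on the next level; i″ is the remaining level.
  -- For x ≢ y the third point is (x′, i) with half (x ⊕ x′) ≡ y.
  across : Z → Z → Fin 3 → Fin 3 → Fin 3 → Point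
  across x y i i′ i″ with x ≟ y
  ... | yes _ = x , i″
  ... | no  _ = (y ⊕ y) ⊖ x , i

  mul : Point → Point → Point
  mul (x , 0F) (y , 0F) = within x y 0F 1F
  mul (x , 0F) (y , 1F) = across x y 0F 1F 2F
  mul (x , 0F) (y , 2F) = across y x 2F 0F 1F
  mul (x , 1F) (y , 0F) = across y x 0F 1F 2F
  mul (x , 1F) (y , 1F) = within x y 1F 2F
  mul (x , 1F) (y , 2F) = across x y 1F 2F 0F
  mul (x , 2F) (y , 0F) = across x y 2F 0F 1F
  mul (x , 2F) (y , 1F) = across y x 1F 2F 0F
  mul (x , 2F) (y , 2F) = within x y 2F 0F

  within-idem : ∀ x i i′ → within x x i i′ ≡ (x , i)
  within-idem x i i′ with x ≟ x
  ... | yes _  = refl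
  ... | no x≢x = contradiction refl x≢x

  within-comm : ∀ x y i i′ → within x y i i′ ≡ within y x i i′
  within-comm x y i i′ with x ≟ y | y ≟ x
  ... | yes refl | yes _   = refl
  ... | yes x≡y  | no y≢x  = contradiction (sym x≡y) y≢x
  ... | no x≢y   | yes y≡x = contradiction (sym y≡x) x≢y
  ... | no _     | no _    = cong (λ z → half z , i′) (⊕-comm x y)

  mul-idem : ∀ p → mul p p ≡ p
  mul-idem (x , 0F) = within-idem x 0F 1F
  mul-idem (x , 1F) = within-idem x 1F 2F
  mul-idem (x , 2F) = within-idem x 2F 0F

  mul-comm : ∀ p q → mul p q ≡ mul q p
  mul-comm (x , 0F) (y , 0F) = within-comm x y 0F 1F
  mul-comm (x , 0F) (y , 1F) = refl
  mul-comm (x , 0F) (y , 2F) = refl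
  mul-comm (x , 1F) (y , 0F) = refl
  mul-comm (x , 1F) (y , 1F) = within-comm x y 1F 2F
  mul-comm (x , 1F) (y , 2F) = refl
  mul-comm (x , 2F) (y , 0F) = refl
  mul-comm (x , 2F) (y , 1F) = refl
  mul-comm (x , 2F) (y , 2F) = within-comm x y 2F 0F

  ≢-half : ∀ {x y} → x ≢ y → x ≢ half (x ⊕ y)
  ≢-half {x} {y} x≢y e = x≢y (⊕-cancelˡ x (trans (cong₂ _⊕_ e e) (double-half (x ⊕ y))))

  ≢-reflect : ∀ {x y} → x ≢ y → x ≢ (y ⊕ y) ⊖ x
  ≢-reflect {x} {y} x≢y e = x≢y (double-injective (trans (cong (x ⊕_) e) (⊕-⊖-cancel x (y ⊕ y))))

  reflect-≢ : ∀ {x y} → x ≢ y → (x ⊕ x) ⊖ y ≢ x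
  reflect-≢ {x} {y} x≢y e = x≢y (sym (⊕-cancelˡ x (trans (sym (cong (_⊕ y) e)) (⊖-⊕ (x ⊕ x) y))))

  -- The law p ∘ (p ∘ q) ≡ q for p on level i.  The three levels behave alike
  -- up to rotation; the equations say how mul acts from level i.
  module FromLevel (i i′ i″ : Fin 3)
    (same : ∀ x y → mul (x , i) (y , i)  ≡ within x y i i′)
    (up   : ∀ x y → mul (x , i) (y , i′) ≡ across x y i i′ i″)
    (down : ∀ x y → mul (x , i) (y , i″) ≡ across y x i″ i i′) where

    inv-same : ∀ x y → mul (x , i) (mul (x , i) (y , i)) ≡ (y , i)
    inv-same x y rewrite same x y with x ≟ y
    ... | yes refl = trans (same x x) (within-idem x i i′)
    ... | no x≢y rewrite up x (half (x ⊕ y)) with x ≟ half (x ⊕ y)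
    ...   | yes e = contradiction e (≢-half x≢y)
    ...   | no _  = cong (_, i) (trans (cong (_⊖ x) (double-half (x ⊕ y))) (⊕-⊖ˡ x y))

    inv-up : ∀ x y → mul (x , i) (mul (x , i) (y , i′)) ≡ (y , i′)
    inv-up x y rewrite up x y with x ≟ y
    ... | yes refl rewrite down x x with x ≟ x
    ...   | yes _  = refl
    ...   | no x≢x = contradiction refl x≢x
    inv-up x y | no x≢y rewrite same x ((y ⊕ y) ⊖ x) with x ≟ (y ⊕ y) ⊖ x
    ...   | yes e = contradiction e (≢-reflect x≢y)
    ...   | no _  = cong (_, i′) (trans (cong half (⊕-⊖-cancel x (y ⊕ y))) (half-double y))

    inv-down : ∀ x y → mul (x , i) (mul (x , i) (y , i″)) ≡ (y , i″)
    inv-down x y rewrite down x y with y ≟ x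
    ... | yes refl rewrite up y y with y ≟ y
    ...   | yes _  = refl
    ...   | no y≢y = contradiction refl y≢y
    inv-down x y | no y≢x rewrite down x ((x ⊕ x) ⊖ y) with (x ⊕ x) ⊖ y ≟ x
    ...   | yes e = contradiction e (reflect-≢ (y≢x ∘ sym))
    ...   | no _  = cong (_, i″) (⊖-involutive (x ⊕ x) y)

  module From0 = FromLevel 0F 1F 2F (λ _ _ → refl) (λ _ _ → refl) (λ _ _ → refl)
  module From1 = FromLevel 1F 2F 0F (λ _ _ → refl) (λ _ _ → refl) (λ _ _ → refl)
  module From2 = FromLevel 2F 0F 1F (λ _ _ → refl) (λ _ _ → refl) (λ _ _ → refl)

  mul-inv : ∀ p q → mul p (mul p q) ≡ q
  mul-inv (x , 0F) (y , 0F) = From0.inv-same x y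
  mul-inv (x , 0F) (y , 1F) = From0.inv-up x y
  mul-inv (x , 0F) (y , 2F) = From0.inv-down x y
  mul-inv (x , 1F) (y , 0F) = From1.inv-down x y
  mul-inv (x , 1F) (y , 1F) = From1.inv-same x y
  mul-inv (x , 1F) (y , 2F) = From1.inv-up x y
  mul-inv (x , 2F) (y , 0F) = From2.inv-up x y
  mul-inv (x , 2F) (y , 1F) = From2.inv-down x y
  mul-inv (x , 2F) (y , 2F) = From2.inv-same x y

  bose : SteinerQuasigroup Point
  bose = record { op = mul ; idem = mul-idem ; comm = mul-comm ; inv = mul-inv }

  translate : (Fin 3 → Z) → Point → Point
  translate d (x , i) = x ⊕ d i , i

  level-≢ : ∀ {x y : Z} {i j : Fin 3} → i ≢ j → (x , i) ≢ (y , j)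
  level-≢ i≢j e = i≢j (cong proj₂ e)

  -- Reflection is compatible with translation only if both levels move alike.
  reflect-translate : ∀ x y a b → ((y ⊕ y) ⊖ x) ⊕ a ≡ ((y ⊕ b) ⊕ (y ⊕ b)) ⊖ (x ⊕ a) → a ≡ b
  reflect-translate x y a b e = double-injective (⊕-cancelˡ (y ⊕ y) (begin
    (y ⊕ y) ⊕ (a ⊕ a)                          ≡⟨ cong (_⊕ (a ⊕ a)) (⊖-⊕ (y ⊕ y) x) ⟨
    (((y ⊕ y) ⊖ x) ⊕ x) ⊕ (a ⊕ a)              ≡⟨ ⊕-interchange ((y ⊕ y) ⊖ x) a x a ⟨
    (((y ⊕ y) ⊖ x) ⊕ a) ⊕ (x ⊕ a)              ≡⟨ cong (_⊕ (x ⊕ a)) e ⟩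
    (((y ⊕ b) ⊕ (y ⊕ b)) ⊖ (x ⊕ a)) ⊕ (x ⊕ a)  ≡⟨ ⊖-⊕ _ (x ⊕ a) ⟩
    (y ⊕ b) ⊕ (y ⊕ b)                          ≡⟨ ⊕-interchange y b y b ⟩
    (y ⊕ y) ⊕ (b ⊕ b)                          ∎))
    where open ≡-Reasoning

  module Twist (d : Fin 3 → Z) where

    module TwistFromLevel (i i′ i″ : Fin 3) (i≢i′ : i ≢ i′) (i≢i″ : i ≢ i″) (di≢di′ : d i ≢ d i′)
      (same : ∀ x y → mul (x , i) (y , i)  ≡ within x y i i′)
      (up   : ∀ x y → mul (x , i) (y , i′) ≡ across x y i i′ i″) where

      twist-same : ∀ x y → x ≢ y → translate d (mul (x , i) (y , i)) ≢ mul (translate d (x , i)) (translate d (y , i))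
      twist-same x y x≢y rewrite same x y | same (x ⊕ d i) (y ⊕ d i) with x ≟ y
      ... | yes x≡y = contradiction x≡y x≢y
      ... | no _ with (x ⊕ d i) ≟ (y ⊕ d i)
      ...   | yes e = contradiction (⊕-cancelʳ (d i) e) x≢y
      ...   | no _  = λ e → di≢di′ (sym (⊕-cancelˡ (half (x ⊕ y)) (trans (cong proj₁ e)
                (trans (cong half (⊕-interchange x (d i) y (d i))) (half-shift (x ⊕ y) (d i))))))

      twist-up : ∀ x y → translate d (mul (x , i) (y , i′)) ≢ mul (translate d (x , i)) (translate d (y , i′))
      twist-up x y rewrite up x y | up (x ⊕ d i) (y ⊕ d i′) with x ≟ y
      twist-up x y | yes refl with (x ⊕ d i) ≟ (x ⊕ d i′)
      ... | yes e = contradiction (⊕-cancelˡ x e) di≢di′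
      ... | no _  = level-≢ (i≢i″ ∘ sym)
      twist-up x y | no _ with (x ⊕ d i) ≟ (y ⊕ d i′)
      ... | yes _ = level-≢ i≢i″
      ... | no _  = λ e → di≢di′ (reflect-translate x y (d i) (d i′) (cong proj₁ e))

    module _ (distinct : ∀ i j → i ≢ j → d i ≢ d j) where
      private
        module T0 = TwistFromLevel 0F 1F 2F (λ ()) (λ ()) (distinct 0F 1F (λ ())) (λ _ _ → refl) (λ _ _ → refl)
        module T1 = TwistFromLevel 1F 2F 0F (λ ()) (λ ()) (distinct 1F 2F (λ ())) (λ _ _ → refl) (λ _ _ → refl)
        module T2 = TwistFromLevel 2F 0F 1F (λ ()) (λ ()) (distinct 2F 0F (λ ())) (λ _ _ → refl) (λ _ _ → refl)

      translate-twists : ∀ p q → p ≢ q → translate d (mul p q) ≢ mul (translate d p) (translate d q)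
      translate-twists (x , 0F) (y , 0F) p≢q = T0.twist-same x y (λ e → p≢q (cong (_, 0F) e))
      translate-twists (x , 0F) (y , 1F) _   = T0.twist-up x y
      translate-twists (x , 0F) (y , 2F) _   = T2.twist-up y x
      translate-twists (x , 1F) (y , 0F) _   = T0.twist-up y x
      translate-twists (x , 1F) (y , 1F) p≢q = T1.twist-same x y (λ e → p≢q (cong (_, 1F) e))
      translate-twists (x , 1F) (y , 2F) _   = T1.twist-up x y
      translate-twists (x , 2F) (y , 0F) _   = T2.twist-up x y
      translate-twists (x , 2F) (y , 1F) _   = T1.twist-up y x
      translate-twists (x , 2F) (y , 2F) p≢q = T2.twist-same x y (λ e → p≢q (cong (_, 2F) e))

  translation : (Fin 3 → Z) → Point ↔ Point
  translation d = mk↔ₛ′ (translate d) (translate (neg ∘ d))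
    (λ { (x , i) → cong (_, i) (⊖-⊕ x (d i)) }) (λ { (x , i) → cong (_, i) (⊕-⊖ x (d i)) })

module BoseTriple (k′ : ℕ) where

  open import Data.Nat using (suc; _+_; _*_; _≤_; s≤s; z≤n)
  open import Data.Nat.Properties using (+-suc)
  open import Data.Fin using (Fin)
  open import Data.Fin.Properties using (*↔×)
  open import Data.Product using (_,_)
  open import Function using (Inverse)
  open import Function.Properties.Inverse using (↔-sym)
  open import Relation.Binary.PropositionalEquality
  open SteinerQuasigroups
  open Transport
  open Bose (suc k′)
  3≤m : 3 ≤ m
  3≤m = s≤s (s≤s (subst (1 ≤_) (sym (+-suc k′ k′)) (s≤s z≤n)))

  open Shifts.InCyclic (suc k′ + suc k′) 3≤m using (U; shift-differences-distinct)

  system : Fin 3 → SteinerQuasigroup Point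
  system c = transport (translation (U c)) bose

  -- β⁻¹ ∘ α is translation by the shift differences δ, which are pairwise distinct.
  systems-disjoint : ∀ a b → a ≢ b → Disjoint (system a) (system b)
  systems-disjoint a b a≢b = conjugates-disjoint bose (translation (U a)) (translation (U b)) twisted
    where
    δ : Fin 3 → Z
    δ i = U a i ⊖ U b i
    γ : Point → Point
    γ p = Inverse.from (translation (U b)) (Inverse.to (translation (U a)) p)
    γ≡ : ∀ p → γ p ≡ translate δ p
    γ≡ (x , i) = cong (_, i) (⊕-assoc x (U a i) (neg (U b i)))
    twisted : ∀ p q → p ≢ q → γ (mul p q) ≢ mul (γ p) (γ q)
    twisted p q p≢q e = Twist.translate-twists δ (shift-differences-distinct a b a≢b) p q p≢q
      (trans (sym (γ≡ (mul p q))) (trans e (cong₂ mul (γ≡ p) (γ≡ q))))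

  v : ℕ
  v = m * 3

  quasigroups : Fin 3 → SQ v
  quasigroups c = transport (↔-sym *↔×) (system c)

  quasigroups-disjoint : ∀ a b → a ≢ b → Disjoint (quasigroups a) (quasigroups b)
  quasigroups-disjoint a b a≢b = transport-disjoint (↔-sym *↔×) (system a) (system b) (systems-disjoint a b a≢b)

module Halving where

  open import Data.Nat using (zero; suc; _+_; ⌊_/2⌋)
  open import Data.Nat.Properties using (+-suc; +-identityʳ)
  open import Data.Sum using (_⊎_; inj₁; inj₂)
  open import Relation.Binary.PropositionalEquality

  parity : ℕ → ℕ
  parity zero          = 0
  parity (suc zero)    = 1
  parity (suc (suc s)) = parity s

  parity-cases : ∀ s → parity s ≡ 0 ⊎ parity s ≡ 1
  parity-cases zero          = inj₁ refl
  parity-cases (suc zero)    = inj₂ refl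
  parity-cases (suc (suc s)) = parity-cases s

  halving : ∀ s → ⌊ s /2⌋ + ⌊ s /2⌋ + parity s ≡ s
  halving zero          = refl
  halving (suc zero)    = refl
  halving (suc (suc s)) = cong suc (trans (cong (_+ parity s) (+-suc ⌊ s /2⌋ ⌊ s /2⌋)) (cong suc (halving s)))

  +-double : ∀ y w → y + suc (suc (w + w)) ≡ suc (suc (y + (w + w)))
  +-double y w = trans (+-suc y (suc (w + w))) (cong suc (+-suc y (w + w)))

  ⌊+double/2⌋ : ∀ y w → ⌊ y + (w + w) /2⌋ ≡ ⌊ y /2⌋ + w
  ⌊+double/2⌋ y zero    = trans (cong ⌊_/2⌋ (+-identityʳ y)) (sym (+-identityʳ ⌊ y /2⌋))
  ⌊+double/2⌋ y (suc w) = trans (cong ⌊_/2⌋ (trans (cong (λ z → y + suc z) (+-suc w w)) (+-double y w)))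
    (trans (cong suc (⌊+double/2⌋ y w)) (sym (+-suc ⌊ y /2⌋ w)))

  parity-+double : ∀ y w → parity (y + (w + w)) ≡ parity y
  parity-+double y zero    = cong parity (+-identityʳ y)
  parity-+double y (suc w) = trans (cong parity (trans (cong (λ z → y + suc z) (+-suc w w)) (+-double y w)))
    (parity-+double y w)

module SkolemArithmetic (n′ : ℕ) where

  open import Data.Nat using (suc; _+_; _*_; _≤_; _<_; _∸_; _%_; _/_; z≤n; s≤s; _<?_; ⌊_/2⌋)
  import Data.Nat.Properties as ℕ
  open import Data.Nat.DivMod using (m≡m%n+[m/n]*n; [m+kn]%n≡m%n; m∣n⇒o%n%m≡o%m; n%n≡0)
  open import Data.Nat.Divisibility using (_∣_; divides)
  open import Data.Nat.Tactic.RingSolver using (solve-∀)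
  open import Data.Fin using (toℕ)
  open import Data.Fin.Properties using (toℕ-injective; toℕ<n)
  open import Data.Sum using (inj₁; inj₂)
  open import Data.Product using (Σ; _,_)
  open import Relation.Nullary using (Dec; yes; no; ¬_; contradiction)
  open import Relation.Binary.PropositionalEquality
  open Halving
  open Cyclic (n′ + suc n′) public
  module Zn = Cyclic n′

  n : ℕ
  n = suc n′

  halveℕ : ℕ → ℕ
  halveℕ s = ⌊ s /2⌋ + parity s * n

  halve : Z → Z
  halve s = mk (halveℕ (toℕ s))

  unhalveℕ : ℕ → ℕ
  unhalveℕ z with z <? n
  ... | yes _ = z + z
  ... | no  _ = suc ((z ∸ n) + (z ∸ n))

  unhalve : Z → Z
  unhalve z = mk (unhalveℕ (toℕ z))

  Low : Z → Set
  Low g = toℕ g < n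

  low? : ∀ g → Dec (Low g)
  low? g = toℕ g <? n

  N : Z
  N = mk n

  flip : Z → Z
  flip g = g ⊕ N

  toℕ-N : toℕ N ≡ n
  toℕ-N = toℕ-mk-< n (ℕ.m<m+n n (s≤s z≤n))

  ⌊/2⌋-< : ∀ s → s < n + n → ⌊ s /2⌋ < n
  ⌊/2⌋-< s s<2n with ⌊ s /2⌋ <? n
  ... | yes h = h
  ... | no ¬h = contradiction (ℕ.<-≤-trans s<2n (ℕ.≤-trans (ℕ.+-mono-≤ (ℕ.≮⇒≥ ¬h) (ℕ.≮⇒≥ ¬h))
                  (subst (⌊ s /2⌋ + ⌊ s /2⌋ ≤_) (halving s) (ℕ.m≤m+n _ (parity s))))) (ℕ.<-irrefl refl)

  toℕ-halve : ∀ s → toℕ (halve s) ≡ halveℕ (toℕ s)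
  toℕ-halve s = toℕ-mk-< _ bound
    where
    S = toℕ s
    bound : halveℕ S < m
    bound with parity-cases S
    ... | inj₁ p≡0 rewrite p≡0 = ℕ.<-≤-trans (subst (_< n) (sym (ℕ.+-identityʳ ⌊ S /2⌋)) (⌊/2⌋-< S (toℕ<n s))) (ℕ.m≤m+n n n)
    ... | inj₂ p≡1 rewrite p≡1 = subst (_< n + n) (cong (⌊ S /2⌋ +_) (sym (ℕ.+-identityʳ n)))
            (ℕ.+-monoˡ-< n (⌊/2⌋-< S (toℕ<n s)))

  unhalveℕ-low : ∀ z → z < n → unhalveℕ z ≡ z + z
  unhalveℕ-low z z<n with z <? n
  ... | yes _ = refl
  ... | no z≮n = contradiction z<n z≮n

  unhalveℕ-high : ∀ z → n ≤ z → unhalveℕ z ≡ suc ((z ∸ n) + (z ∸ n))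
  unhalveℕ-high z n≤z with z <? n
  ... | yes z<n = contradiction n≤z (ℕ.<⇒≱ z<n)
  ... | no _    = refl

  toℕ-unhalve : ∀ z → toℕ (unhalve z) ≡ unhalveℕ (toℕ z)
  toℕ-unhalve z = toℕ-mk-< _ bound
    where
    Z′ = toℕ z
    bound : unhalveℕ Z′ < m
    bound with Z′ <? n
    ... | yes z<n = ℕ.+-mono-< z<n z<n
    ... | no z≮n  = subst (_≤ n + n) (cong suc (ℕ.+-suc (Z′ ∸ n) (Z′ ∸ n))) (ℕ.+-mono-≤ w<n w<n)
      where
      w<n : Z′ ∸ n < n
      w<n = subst (Z′ ∸ n <_) (ℕ.m+n∸n≡m n n) (ℕ.∸-monoˡ-< (toℕ<n z) (ℕ.≮⇒≥ z≮n))

  halve-unhalve : ∀ z → halve (unhalve z) ≡ z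
  halve-unhalve z = toℕ-injective (trans (toℕ-halve (unhalve z)) (trans (cong halveℕ (toℕ-unhalve z)) (go (toℕ z <? n))))
    where
    Z′ = toℕ z
    go : Dec (Z′ < n) → halveℕ (unhalveℕ Z′) ≡ Z′
    go (yes z<n) rewrite unhalveℕ-low Z′ z<n | ⌊+double/2⌋ 0 Z′ | parity-+double 0 Z′ = ℕ.+-identityʳ Z′
    go (no z≮n) rewrite unhalveℕ-high Z′ (ℕ.≮⇒≥ z≮n) | ⌊+double/2⌋ 1 (Z′ ∸ n) | parity-+double 1 (Z′ ∸ n) =
      trans (cong ((Z′ ∸ n) +_) (ℕ.+-identityʳ n)) (ℕ.m∸n+n≡m (ℕ.≮⇒≥ z≮n))

  unhalve-halve : ∀ s → unhalve (halve s) ≡ s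
  unhalve-halve s = toℕ-injective (trans (toℕ-unhalve (halve s)) (trans (cong unhalveℕ (toℕ-halve s)) go))
    where
    S = toℕ s
    h<n = ⌊/2⌋-< S (toℕ<n s)
    go : unhalveℕ (halveℕ S) ≡ S
    go with parity-cases S
    ... | inj₁ p≡0 = begin
      unhalveℕ (⌊ S /2⌋ + parity S * n)   ≡⟨ cong (λ p → unhalveℕ (⌊ S /2⌋ + p * n)) p≡0 ⟩
      unhalveℕ (⌊ S /2⌋ + 0)              ≡⟨ cong unhalveℕ (ℕ.+-identityʳ ⌊ S /2⌋) ⟩
      unhalveℕ ⌊ S /2⌋                    ≡⟨ unhalveℕ-low ⌊ S /2⌋ h<n ⟩
      ⌊ S /2⌋ + ⌊ S /2⌋                   ≡⟨ ℕ.+-identityʳ _ ⟨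
      ⌊ S /2⌋ + ⌊ S /2⌋ + 0               ≡⟨ cong (⌊ S /2⌋ + ⌊ S /2⌋ +_) p≡0 ⟨
      ⌊ S /2⌋ + ⌊ S /2⌋ + parity S        ≡⟨ halving S ⟩
      S                                   ∎
      where open ≡-Reasoning
    ... | inj₂ p≡1 = begin
      unhalveℕ (⌊ S /2⌋ + parity S * n)   ≡⟨ cong (λ p → unhalveℕ (⌊ S /2⌋ + p * n)) p≡1 ⟩
      unhalveℕ (⌊ S /2⌋ + (n + 0))        ≡⟨ cong (λ x → unhalveℕ (⌊ S /2⌋ + x)) (ℕ.+-identityʳ n) ⟩
      unhalveℕ (⌊ S /2⌋ + n)              ≡⟨ unhalveℕ-high (⌊ S /2⌋ + n) (ℕ.m≤n+m n ⌊ S /2⌋) ⟩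
      suc (⌊ S /2⌋ + n ∸ n + (⌊ S /2⌋ + n ∸ n)) ≡⟨ cong (λ w → suc (w + w)) (ℕ.m+n∸n≡m ⌊ S /2⌋ n) ⟩
      suc (⌊ S /2⌋ + ⌊ S /2⌋)             ≡⟨ ℕ.+-comm 1 _ ⟩
      ⌊ S /2⌋ + ⌊ S /2⌋ + 1               ≡⟨ cong (⌊ S /2⌋ + ⌊ S /2⌋ +_) p≡1 ⟨
      ⌊ S /2⌋ + ⌊ S /2⌋ + parity S        ≡⟨ halving S ⟩
      S                                   ∎
      where open ≡-Reasoning

  halve-injective : ∀ {a b} → halve a ≡ halve b → a ≡ b
  halve-injective {a} {b} e = trans (sym (unhalve-halve a)) (trans (cong unhalve e) (unhalve-halve b))

  halve-double-low : ∀ g → Low g → halve (g ⊕ g) ≡ g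
  halve-double-low g low = toℕ-injective (begin
    toℕ (halve (g ⊕ g))                          ≡⟨ toℕ-halve (g ⊕ g) ⟩
    halveℕ (toℕ (mk (toℕ g + toℕ g)))            ≡⟨ cong halveℕ (toℕ-mk-< _ (ℕ.+-mono-< low low)) ⟩
    ⌊ toℕ g + toℕ g /2⌋ + parity (toℕ g + toℕ g) * n ≡⟨ cong₂ (λ a b → a + b * n) (⌊+double/2⌋ 0 (toℕ g)) (parity-+double 0 (toℕ g)) ⟩
    toℕ g + 0                                     ≡⟨ ℕ.+-identityʳ (toℕ g) ⟩
    toℕ g                                         ∎)
    where open ≡-Reasoning

  toℕ-flip-low : ∀ g → Low g → toℕ (flip g) ≡ toℕ g + n
  toℕ-flip-low g low = trans (cong (λ w → toℕ (mk (toℕ g + w))) toℕ-N) (toℕ-mk-< _ (ℕ.+-monoˡ-< n low))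

  toℕ-flip-high : ∀ g → ¬ Low g → toℕ (flip g) ≡ toℕ g ∸ n
  toℕ-flip-high g high = begin
    toℕ (mk (toℕ g + toℕ N))  ≡⟨ cong (λ w → toℕ (mk (toℕ g + w))) toℕ-N ⟩
    toℕ (mk (G + n))          ≡⟨ toℕ-mk (G + n) ⟩
    (G + n) % m               ≡⟨ %-wrap (G + n) (ℕ.+-monoˡ-≤ n (ℕ.≮⇒≥ high)) (subst (_< m) (sym wrap≡) (ℕ.≤-<-trans (ℕ.m∸n≤m G n) (toℕ<n g))) ⟩
    G + n ∸ (n + n)           ≡⟨ wrap≡ ⟩
    G ∸ n                     ∎
    where
    open ≡-Reasoning
    G = toℕ g
    wrap≡ : G + n ∸ (n + n) ≡ G ∸ n
    wrap≡ = trans (sym (ℕ.∸-+-assoc (G + n) n n)) (cong (_∸ n) (ℕ.m+n∸n≡m G n))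

  halve-double-high : ∀ g → ¬ Low g → halve (g ⊕ g) ≡ flip g
  halve-double-high g high = toℕ-injective (begin
    toℕ (halve (g ⊕ g))              ≡⟨ toℕ-halve (g ⊕ g) ⟩
    halveℕ (toℕ (g ⊕ g))             ≡⟨ cong halveℕ toℕ-g⊕g ⟩
    halveℕ (w + w)                   ≡⟨ cong₂ (λ a b → a + b * n) (⌊+double/2⌋ 0 w) (parity-+double 0 w) ⟩
    w + 0                            ≡⟨ ℕ.+-identityʳ w ⟩
    w                                ≡⟨ toℕ-flip-high g high ⟨
    toℕ (flip g)                     ∎)
    where
    open ≡-Reasoning
    G = toℕ g
    w = G ∸ n
    n≤G : n ≤ G
    n≤G = ℕ.≮⇒≥ high
    rearrange : ∀ w n → w + n + (w + n) ≡ w + w + (n + n)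
    rearrange = solve-∀
    unwrap : w + n + (w + n) ∸ (n + n) ≡ w + w
    unwrap = trans (cong (_∸ (n + n)) (rearrange w n)) (ℕ.m+n∸n≡m (w + w) (n + n))
    toℕ-g⊕g : toℕ (g ⊕ g) ≡ w + w
    toℕ-g⊕g = begin
      toℕ (mk (G + G))             ≡⟨ toℕ-mk (G + G) ⟩
      (G + G) % m                  ≡⟨ cong (λ z → (z + z) % m) (ℕ.m∸n+n≡m n≤G) ⟨
      (w + n + (w + n)) % m        ≡⟨ %-wrap (w + n + (w + n)) (ℕ.+-mono-≤ (ℕ.m≤n+m n w) (ℕ.m≤n+m n w))
                                       (subst (_< m) (sym unwrap) (ℕ.+-mono-< w<n w<n)) ⟩
      w + n + (w + n) ∸ (n + n)    ≡⟨ unwrap ⟩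
      w + w                        ∎
      where
      w<n : w < n
      w<n = subst (w <_) (ℕ.m+n∸n≡m n n) (ℕ.∸-monoˡ-< (toℕ<n g) n≤G)

  N⊕N : N ⊕ N ≡ 𝟎
  N⊕N = toℕ-injective (trans (toℕ-mk (toℕ N + toℕ N)) (trans (cong (λ z → (z + z) % m) toℕ-N) (n%n≡0 m)))

  flip-involutive : ∀ g → flip (flip g) ≡ g
  flip-involutive g = trans (⊕-assoc g N N) (trans (cong (g ⊕_) N⊕N) (⊕-identityʳ g))

  flip-low : ∀ g → Low g → ¬ Low (flip g)
  flip-low g low low′ = ℕ.<-irrefl refl (ℕ.<-≤-trans (subst (_< n) (toℕ-flip-low g low) low′) (ℕ.m≤n+m n (toℕ g)))

  flip-high : ∀ g → ¬ Low g → Low (flip g)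
  flip-high g high = subst (_< n) (sym (toℕ-flip-high g high))
    (subst (toℕ g ∸ n <_) (ℕ.m+n∸n≡m n n) (ℕ.∸-monoˡ-< (toℕ<n g) (ℕ.≮⇒≥ high)))

  flip-double : ∀ g → flip g ⊕ flip g ≡ g ⊕ g
  flip-double g = trans (⊕-interchange g N g N) (trans (cong ((g ⊕ g) ⊕_) N⊕N) (⊕-identityʳ (g ⊕ g)))

  flip-shift : ∀ g a b → flip g ⊕ a ≡ flip (g ⊕ b) → a ≡ b
  flip-shift g a b e = ⊕-cancelˡ (flip g) (trans e
    (trans (⊕-assoc g b N) (trans (cong (g ⊕_) (⊕-comm b N)) (sym (⊕-assoc g N b)))))

  reduce : Z → Zn.Z
  reduce z = Zn.mk (toℕ z)

  n∣m : n ∣ m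
  n∣m = divides 2 (cong (n +_) (sym (ℕ.+-identityʳ n)))

  reduce-mk : ∀ s → reduce (mk s) ≡ Zn.mk s
  reduce-mk s = Zn.mk-≡ (toℕ (mk s)) s (trans (cong (_% n) (toℕ-mk s)) (m∣n⇒o%n%m≡o%m n m s n∣m))

  reduce-⊕ : ∀ a b → reduce (a ⊕ b) ≡ reduce a Zn.⊕ reduce b
  reduce-⊕ a b = trans (reduce-mk (toℕ a + toℕ b)) (sym (Zn.mk-+ (toℕ a) (toℕ b)))

  reduce-⊖ : ∀ a b → reduce (a ⊖ b) ≡ reduce a Zn.⊖ reduce b
  reduce-⊖ a b = Zn.⊕≡⇒≡⊖ (trans (sym (reduce-⊕ (a ⊖ b) b)) (cong reduce (⊖-⊕ a b)))

  reduce-halve : ∀ s → reduce (halve s) ≡ Zn.mk ⌊ toℕ s /2⌋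
  reduce-halve s = trans (reduce-mk (halveℕ (toℕ s)))
    (Zn.mk-≡ (halveℕ (toℕ s)) ⌊ toℕ s /2⌋ ([m+kn]%n≡m%n ⌊ toℕ s /2⌋ (parity (toℕ s)) n))

  lift-⊕-double : ∀ s t → Σ ℕ λ c → toℕ (s ⊕ (t ⊕ t)) + (c * n + c * n) ≡ toℕ s + (toℕ t + toℕ t)
  lift-⊕-double s t = c₁ + c₂ , sym (begin
    S + (T + T)              ≡⟨ cong (S +_) (remainder (T + T)) ⟩
    S + (Y + c₂ * m)         ≡⟨ ℕ.+-assoc S Y (c₂ * m) ⟨
    S + Y + c₂ * m           ≡⟨ cong (_+ c₂ * m) (remainder (S + Y)) ⟩
    X + c₁ * m + c₂ * m      ≡⟨ ℕ.+-assoc X (c₁ * m) (c₂ * m) ⟩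
    X + (c₁ * m + c₂ * m)    ≡⟨ cong (X +_) (ℕ.*-distribʳ-+ m c₁ c₂) ⟨
    X + (c₁ + c₂) * m        ≡⟨ cong (X +_) (times-2n (c₁ + c₂) n′) ⟩
    X + ((c₁ + c₂) * n + (c₁ + c₂) * n) ∎)
    where
    open ≡-Reasoning
    S = toℕ s
    T = toℕ t
    Y = toℕ (t ⊕ t)
    X = toℕ (s ⊕ (t ⊕ t))
    remainder : ∀ a → a ≡ toℕ (mk a) + (a / m) * m
    remainder a = trans (m≡m%n+[m/n]*n a m) (cong (_+ (a / m) * m) (sym (toℕ-mk a)))
    c₁ = (S + Y) / m
    c₂ = (T + T) / m
    times-2n : ∀ c n′ → c * suc (n′ + suc n′) ≡ c * suc n′ + c * suc n′
    times-2n = solve-∀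

  reduce-halve-shift : ∀ s t → reduce (halve (s ⊕ (t ⊕ t))) ≡ reduce (halve s) Zn.⊕ reduce t
  reduce-halve-shift s t with lift-⊕-double s t
  ... | c , lift = begin
    reduce (halve (s ⊕ (t ⊕ t)))     ≡⟨ reduce-halve (s ⊕ (t ⊕ t)) ⟩
    Zn.mk ⌊ X /2⌋                    ≡⟨ Zn.mk-≡ ⌊ X /2⌋ (⌊ S /2⌋ + T) same-mod-n ⟩
    Zn.mk (⌊ S /2⌋ + T)              ≡⟨ Zn.mk-+ ⌊ S /2⌋ T ⟨
    Zn.mk ⌊ S /2⌋ Zn.⊕ reduce t      ≡⟨ cong (Zn._⊕ reduce t) (reduce-halve s) ⟨
    reduce (halve s) Zn.⊕ reduce t   ∎
    where
    open ≡-Reasoning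
    S = toℕ s
    T = toℕ t
    X = toℕ (s ⊕ (t ⊕ t))
    halves : ⌊ X /2⌋ + c * n ≡ ⌊ S /2⌋ + T
    halves = trans (sym (⌊+double/2⌋ X (c * n))) (trans (cong ⌊_/2⌋ lift) (⌊+double/2⌋ S T))
    same-mod-n : ⌊ X /2⌋ % n ≡ (⌊ S /2⌋ + T) % n
    same-mod-n = trans (sym ([m+kn]%n≡m%n ⌊ X /2⌋ c n)) (cong (_% n) halves)

-- Skolem's construction of a Steiner quasigroup on {∞} ∪ ℤ_2n × {0, 1, 2}
-- (v = 6n + 1).  With the half-idempotent commutative quasigroup
-- x ∘ y = halve (x + y) on ℤ_2n the blocks are
--   {(x,0), (x,1), (x,2)} and {∞, (x + n, i), (x, i+1)} for x in the low half,
--   {(x,i), (y,i), (x ∘ y, i+1)} for x ≢ y.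
-- As for Bose, translating the levels by amounts that are pairwise distinct
-- modulo n yields a disjoint system.
module Skolem (n′ : ℕ) where

  open import Data.Fin using (Fin; _≟_)
  open import Data.Fin.Patterns using (0F; 1F; 2F)
  open import Function using (_∘_; _↔_; mk↔ₛ′)
  open import Relation.Nullary using (yes; no; contradiction)
  open import Relation.Binary.PropositionalEquality
  open SteinerQuasigroups using (SteinerQuasigroup)
  open SkolemArithmetic n′ public

  data Point : Set where
    ∞  : Point
    pt : Z → Fin 3 → Point

  pt-injective₁ : ∀ {a b i j} → pt a i ≡ pt b j → a ≡ b
  pt-injective₁ refl = refl

  pt-injective₂ : ∀ {a b i j} → pt a i ≡ pt b j → i ≡ j
  pt-injective₂ refl = refl

  with-∞ : Z → Fin 3 → Fin 3 → Point
  with-∞ g i′ i″ with low? g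
  ... | yes _ = pt (flip g) i″
  ... | no  _ = pt (flip g) i′

  within : Z → Z → Fin 3 → Fin 3 → Point
  within x y i i′ with x ≟ y
  ... | yes _ = pt x i
  ... | no  _ = pt (halve (x ⊕ y)) i′

  across : Z → Z → Fin 3 → Fin 3 → Fin 3 → Point
  across g g′ i i′ i″ with g′ ≟ halve (g ⊕ g) | low? g
  ... | yes _ | yes _ = pt g i″
  ... | yes _ | no  _ = ∞
  ... | no  _ | _     = pt (unhalve g′ ⊖ g) i

  mul : Point → Point → Point
  mul ∞         ∞         = ∞
  mul ∞         (pt g 0F) = with-∞ g 1F 2F
  mul ∞         (pt g 1F) = with-∞ g 2F 0F
  mul ∞         (pt g 2F) = with-∞ g 0F 1F
  mul (pt g 0F) ∞         = with-∞ g 1F 2F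
  mul (pt g 1F) ∞         = with-∞ g 2F 0F
  mul (pt g 2F) ∞         = with-∞ g 0F 1F
  mul (pt x 0F) (pt y 0F) = within x y 0F 1F
  mul (pt x 0F) (pt y 1F) = across x y 0F 1F 2F
  mul (pt x 0F) (pt y 2F) = across y x 2F 0F 1F
  mul (pt x 1F) (pt y 0F) = across y x 0F 1F 2F
  mul (pt x 1F) (pt y 1F) = within x y 1F 2F
  mul (pt x 1F) (pt y 2F) = across x y 1F 2F 0F
  mul (pt x 2F) (pt y 0F) = across x y 2F 0F 1F
  mul (pt x 2F) (pt y 1F) = across y x 1F 2F 0F
  mul (pt x 2F) (pt y 2F) = within x y 2F 0F

  within-idem : ∀ x i i′ → within x x i i′ ≡ pt x i
  within-idem x i i′ with x ≟ x
  ... | yes _  = refl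
  ... | no x≢x = contradiction refl x≢x

  within-comm : ∀ x y i i′ → within x y i i′ ≡ within y x i i′
  within-comm x y i i′ with x ≟ y | y ≟ x
  ... | yes refl | yes _   = refl
  ... | yes x≡y  | no y≢x  = contradiction (sym x≡y) y≢x
  ... | no x≢y   | yes y≡x = contradiction (sym y≡x) x≢y
  ... | no _     | no _    = cong (λ z → pt (halve z) i′) (⊕-comm x y)

  mul-idem : ∀ p → mul p p ≡ p
  mul-idem ∞         = refl
  mul-idem (pt x 0F) = within-idem x 0F 1F
  mul-idem (pt x 1F) = within-idem x 1F 2F
  mul-idem (pt x 2F) = within-idem x 2F 0F

  mul-comm : ∀ p q → mul p q ≡ mul q p
  mul-comm ∞         ∞         = refl
  mul-comm ∞         (pt g 0F) = refl
  mul-comm ∞         (pt g 1F) = refl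
  mul-comm ∞         (pt g 2F) = refl
  mul-comm (pt g 0F) ∞         = refl
  mul-comm (pt g 1F) ∞         = refl
  mul-comm (pt g 2F) ∞         = refl
  mul-comm (pt x 0F) (pt y 0F) = within-comm x y 0F 1F
  mul-comm (pt x 0F) (pt y 1F) = refl
  mul-comm (pt x 0F) (pt y 2F) = refl
  mul-comm (pt x 1F) (pt y 0F) = refl
  mul-comm (pt x 1F) (pt y 1F) = within-comm x y 1F 2F
  mul-comm (pt x 1F) (pt y 2F) = refl
  mul-comm (pt x 2F) (pt y 0F) = refl
  mul-comm (pt x 2F) (pt y 1F) = refl
  mul-comm (pt x 2F) (pt y 2F) = within-comm x y 2F 0F

  -- The law p ∘ (p ∘ q) ≡ q for p on level i or p = ∞; the equations say
  -- how mul acts from level i (the three levels behave alike up to rotation).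
  module FromLevel (i i′ i″ : Fin 3)
    (same   : ∀ x y → mul (pt x i) (pt y i)  ≡ within x y i i′)
    (up     : ∀ x y → mul (pt x i) (pt y i′) ≡ across x y i i′ i″)
    (down   : ∀ x y → mul (pt x i) (pt y i″) ≡ across y x i″ i i′)
    (to-∞   : ∀ x → mul (pt x i) ∞ ≡ with-∞ x i′ i″)
    (from-∞ : ∀ x → mul ∞ (pt x i) ≡ with-∞ x i′ i″)
    (∞-up   : ∀ x → mul ∞ (pt x i′) ≡ with-∞ x i″ i)
    (∞-down : ∀ x → mul ∞ (pt x i″) ≡ with-∞ x i i′) where

    inv-same : ∀ g g′ → mul (pt g i) (mul (pt g i) (pt g′ i)) ≡ pt g′ i
    inv-same g g′ rewrite same g g′ with g ≟ g′
    ... | yes refl = trans (same g g) (within-idem g i i′)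
    ... | no g≢g′ rewrite up g (halve (g ⊕ g′)) with halve (g ⊕ g′) ≟ halve (g ⊕ g)
    ...   | yes e = contradiction (sym (⊕-cancelˡ g (halve-injective e))) g≢g′
    ...   | no _  = cong (λ z → pt z i) (trans (cong (_⊖ g) (unhalve-halve (g ⊕ g′))) (⊕-⊖ˡ g g′))

    inv-up : ∀ g g′ → mul (pt g i) (mul (pt g i) (pt g′ i′)) ≡ pt g′ i′
    inv-up g g′ rewrite up g g′ with g′ ≟ halve (g ⊕ g) | low? g
    ... | yes g′≡ | yes low rewrite down g g with g ≟ halve (g ⊕ g) | low? g
    ...   | yes _ | yes _    = cong (λ z → pt z i′) (sym (trans g′≡ (halve-double-low g low)))
    ...   | yes _ | no high  = contradiction low high
    ...   | no g≢ | _        = contradiction (sym (halve-double-low g low)) g≢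
    inv-up g g′ | yes g′≡ | no high rewrite to-∞ g with low? g
    ...   | yes low = contradiction low high
    ...   | no _    = cong (λ z → pt z i′) (sym (trans g′≡ (halve-double-high g high)))
    inv-up g g′ | no g′≢ | _ rewrite same g (unhalve g′ ⊖ g) with g ≟ unhalve g′ ⊖ g
    ...   | yes e = contradiction (sym (trans (cong halve (trans (cong (_⊕ g) e)
                      (trans (⊕-comm (unhalve g′ ⊖ g) g) (⊕-⊖-cancel g (unhalve g′))))) (halve-unhalve g′))) g′≢
    ...   | no _  = cong (λ z → pt z i′) (trans (cong halve (⊕-⊖-cancel g (unhalve g′))) (halve-unhalve g′))

    inv-down : ∀ g g′ → mul (pt g i) (mul (pt g i) (pt g′ i″)) ≡ pt g′ i″
    inv-down g g′ rewrite down g g′ with g ≟ halve (g′ ⊕ g′) | low? g′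
    ... | yes g≡ | yes low with trans g≡ (halve-double-low g′ low)
    ...   | refl rewrite up g g with g ≟ halve (g ⊕ g) | low? g
    ...     | yes _ | yes _   = refl
    ...     | yes _ | no high = contradiction low high
    ...     | no g≢ | _       = contradiction g≡ g≢
    inv-down g g′ | yes g≡ | no high rewrite to-∞ g with low? g
    ...   | yes _    = cong (λ z → pt z i″) (trans (cong flip (trans g≡ (halve-double-high g′ high))) (flip-involutive g′))
    ...   | no high′ = contradiction (subst Low (sym (trans g≡ (halve-double-high g′ high))) (flip-high g′ high)) high′
    inv-down g g′ | no g≢ | _ rewrite down g (unhalve g ⊖ g′)
      with g ≟ halve ((unhalve g ⊖ g′) ⊕ (unhalve g ⊖ g′)) | low? (unhalve g ⊖ g′)
    ...   | yes e | _ = contradiction (trans e (cong (λ z → halve (z ⊕ z)) w≡g′)) g≢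
      where
      w≡g′ : unhalve g ⊖ g′ ≡ g′
      w≡g′ = ⊕-cancelˡ (unhalve g ⊖ g′) (trans (sym (trans (cong unhalve e) (unhalve-halve _))) (sym (⊖-⊕ (unhalve g) g′)))
    ...   | no _ | _ = cong (λ z → pt z i″) (⊖-involutive (unhalve g) g′)

    inv-∞ : ∀ g → mul (pt g i) (mul (pt g i) ∞) ≡ ∞
    inv-∞ g rewrite to-∞ g with low? g
    ... | yes low rewrite down g (flip g) with g ≟ halve (flip g ⊕ flip g) | low? (flip g)
    ...   | yes _ | yes low′ = contradiction low′ (flip-low g low)
    ...   | yes _ | no _     = refl
    ...   | no g≢ | _        = contradiction (sym (trans (cong halve (flip-double g)) (halve-double-low g low))) g≢
    inv-∞ g | no high rewrite up g (flip g) with flip g ≟ halve (g ⊕ g) | low? g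
    ...   | yes _ | yes low = contradiction low high
    ...   | yes _ | no _    = refl
    ...   | no g≢ | _       = contradiction (sym (halve-double-high g high)) g≢

    ∞-inv : ∀ g → mul ∞ (mul ∞ (pt g i)) ≡ pt g i
    ∞-inv g rewrite from-∞ g with low? g
    ... | yes low rewrite ∞-down (flip g) with low? (flip g)
    ...   | yes low′ = contradiction low′ (flip-low g low)
    ...   | no _     = cong (λ z → pt z i) (flip-involutive g)
    ∞-inv g | no high rewrite ∞-up (flip g) with low? (flip g)
    ...   | yes _     = cong (λ z → pt z i) (flip-involutive g)
    ...   | no high′  = contradiction (flip-high g high) high′

  module From0 = FromLevel 0F 1F 2F (λ _ _ → refl) (λ _ _ → refl) (λ _ _ → refl) (λ _ → refl) (λ _ → refl) (λ _ → refl) (λ _ → refl)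
  module From1 = FromLevel 1F 2F 0F (λ _ _ → refl) (λ _ _ → refl) (λ _ _ → refl) (λ _ → refl) (λ _ → refl) (λ _ → refl) (λ _ → refl)
  module From2 = FromLevel 2F 0F 1F (λ _ _ → refl) (λ _ _ → refl) (λ _ _ → refl) (λ _ → refl) (λ _ → refl) (λ _ → refl) (λ _ → refl)

  mul-inv : ∀ p q → mul p (mul p q) ≡ q
  mul-inv ∞         ∞         = refl
  mul-inv ∞         (pt g 0F) = From0.∞-inv g
  mul-inv ∞         (pt g 1F) = From1.∞-inv g
  mul-inv ∞         (pt g 2F) = From2.∞-inv g
  mul-inv (pt g 0F) ∞         = From0.inv-∞ g
  mul-inv (pt g 1F) ∞         = From1.inv-∞ g
  mul-inv (pt g 2F) ∞         = From2.inv-∞ g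
  mul-inv (pt x 0F) (pt y 0F) = From0.inv-same x y
  mul-inv (pt x 0F) (pt y 1F) = From0.inv-up x y
  mul-inv (pt x 0F) (pt y 2F) = From0.inv-down x y
  mul-inv (pt x 1F) (pt y 0F) = From1.inv-down x y
  mul-inv (pt x 1F) (pt y 1F) = From1.inv-same x y
  mul-inv (pt x 1F) (pt y 2F) = From1.inv-up x y
  mul-inv (pt x 2F) (pt y 0F) = From2.inv-up x y
  mul-inv (pt x 2F) (pt y 1F) = From2.inv-down x y
  mul-inv (pt x 2F) (pt y 2F) = From2.inv-same x y

  skolem : SteinerQuasigroup Point
  skolem = record { op = mul ; idem = mul-idem ; comm = mul-comm ; inv = mul-inv }

  translate : (Fin 3 → Z) → Point → Point
  translate d ∞        = ∞
  translate d (pt g i) = pt (g ⊕ d i) i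

  translation : (Fin 3 → Z) → Point ↔ Point
  translation d = mk↔ₛ′ (translate d) (translate (neg ∘ d))
    (λ { ∞ → refl ; (pt g i) → cong (λ z → pt z i) (⊖-⊕ g (d i)) })
    (λ { ∞ → refl ; (pt g i) → cong (λ z → pt z i) (⊕-⊖ g (d i)) })

  reflect-translate : ∀ e e′ x a → (e ⊖ x) ⊕ a ≡ e′ ⊖ (x ⊕ a) → e′ ≡ e ⊕ (a ⊕ a)
  reflect-translate e e′ x a q = begin
    e′                          ≡⟨ ⊖-⊕ e′ (x ⊕ a) ⟨
    (e′ ⊖ (x ⊕ a)) ⊕ (x ⊕ a)    ≡⟨ cong (_⊕ (x ⊕ a)) q ⟨
    ((e ⊖ x) ⊕ a) ⊕ (x ⊕ a)     ≡⟨ ⊕-interchange (e ⊖ x) a x a ⟩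
    ((e ⊖ x) ⊕ x) ⊕ (a ⊕ a)     ≡⟨ cong (_⊕ (a ⊕ a)) (⊖-⊕ e x) ⟩
    e ⊕ (a ⊕ a)                 ∎
    where open ≡-Reasoning

  module Twist (d : Fin 3 → Z) (distinct : ∀ j k → j ≢ k → reduce (d j) ≢ reduce (d k)) where

    shifted-apart : ∀ {i i′} → i ≢ i′ → ∀ x → reduce x Zn.⊕ reduce (d i′) ≢ reduce x Zn.⊕ reduce (d i)
    shifted-apart i≢i′ x e = distinct _ _ (i≢i′ ∘ sym) (Zn.⊕-cancelˡ (reduce x) e)

    module TwistFromLevel (i i′ i″ : Fin 3) (i≢i′ : i ≢ i′) (i≢i″ : i ≢ i″)
      (same  : ∀ x y → mul (pt x i) (pt y i) ≡ within x y i i′)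
      (up    : ∀ x y → mul (pt x i) (pt y i′) ≡ across x y i i′ i″)
      (to-∞  : ∀ x → mul (pt x i) ∞ ≡ with-∞ x i′ i″) where

      twist-same : ∀ g g′ → g ≢ g′ → translate d (mul (pt g i) (pt g′ i)) ≢ mul (pt (g ⊕ d i) i) (pt (g′ ⊕ d i) i)
      twist-same g g′ g≢g′ rewrite same g g′ | same (g ⊕ d i) (g′ ⊕ d i) with g ≟ g′ | (g ⊕ d i) ≟ (g′ ⊕ d i)
      ... | yes e | _     = contradiction e g≢g′
      ... | no _  | yes e = contradiction (⊕-cancelʳ (d i) e) g≢g′
      ... | no _  | no _  = λ E → shifted-apart i≢i′ (halve (g ⊕ g′)) (begin
          reduce (halve (g ⊕ g′)) Zn.⊕ reduce (d i′)   ≡⟨ reduce-⊕ (halve (g ⊕ g′)) (d i′) ⟨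
          reduce (halve (g ⊕ g′) ⊕ d i′)               ≡⟨ cong reduce (pt-injective₁ E) ⟩
          reduce (halve ((g ⊕ d i) ⊕ (g′ ⊕ d i)))      ≡⟨ cong (reduce ∘ halve) (⊕-interchange g (d i) g′ (d i)) ⟩
          reduce (halve ((g ⊕ g′) ⊕ (d i ⊕ d i)))      ≡⟨ reduce-halve-shift (g ⊕ g′) (d i) ⟩
          reduce (halve (g ⊕ g′)) Zn.⊕ reduce (d i)    ∎)
        where open ≡-Reasoning

      twist-up : ∀ g g′ → translate d (mul (pt g i) (pt g′ i′)) ≢ mul (pt (g ⊕ d i) i) (pt (g′ ⊕ d i′) i′)
      twist-up g g′ rewrite up g g′ | up (g ⊕ d i) (g′ ⊕ d i′)
        with g′ ≟ halve (g ⊕ g) | low? g | (g′ ⊕ d i′) ≟ halve ((g ⊕ d i) ⊕ (g ⊕ d i)) | low? (g ⊕ d i)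
      ... | yes g′≡ | _ | yes g′≡′ | _ = contradiction (begin
          reduce g′ Zn.⊕ reduce (d i′)                 ≡⟨ reduce-⊕ g′ (d i′) ⟨
          reduce (g′ ⊕ d i′)                           ≡⟨ cong reduce g′≡′ ⟩
          reduce (halve ((g ⊕ d i) ⊕ (g ⊕ d i)))       ≡⟨ cong (reduce ∘ halve) (⊕-interchange g (d i) g (d i)) ⟩
          reduce (halve ((g ⊕ g) ⊕ (d i ⊕ d i)))       ≡⟨ reduce-halve-shift (g ⊕ g) (d i) ⟩
          reduce (halve (g ⊕ g)) Zn.⊕ reduce (d i)     ≡⟨ cong (λ z → reduce z Zn.⊕ reduce (d i)) g′≡ ⟨
          reduce g′ Zn.⊕ reduce (d i)                  ∎) (shifted-apart i≢i′ g′)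
        where open ≡-Reasoning
      ... | yes _ | yes _ | no _ | _ = λ E → i≢i″ (sym (pt-injective₂ E))
      ... | yes _ | no _  | no _ | _ = λ ()
      ... | no _ | _ | yes _ | yes _ = λ E → i≢i″ (pt-injective₂ E)
      ... | no _ | _ | yes _ | no _  = λ ()
      ... | no _ | _ | no _  | _     = λ E → shifted-apart i≢i′ g′ (begin
          reduce g′ Zn.⊕ reduce (d i′)                 ≡⟨ reduce-⊕ g′ (d i′) ⟨
          reduce (g′ ⊕ d i′)                           ≡⟨ cong reduce (halve-unhalve (g′ ⊕ d i′)) ⟨
          reduce (halve (unhalve (g′ ⊕ d i′)))         ≡⟨ cong (reduce ∘ halve) (reflect-translate (unhalve g′) (unhalve (g′ ⊕ d i′)) g (d i) (pt-injective₁ E)) ⟩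
          reduce (halve (unhalve g′ ⊕ (d i ⊕ d i)))    ≡⟨ reduce-halve-shift (unhalve g′) (d i) ⟩
          reduce (halve (unhalve g′)) Zn.⊕ reduce (d i) ≡⟨ cong (λ z → reduce z Zn.⊕ reduce (d i)) (halve-unhalve g′) ⟩
          reduce g′ Zn.⊕ reduce (d i)                  ∎)
        where open ≡-Reasoning

      -- ∞ is fixed, but its partner flip g moves with its level.
      flip-apart : ∀ g {j} → i ≢ j → flip g ⊕ d j ≢ flip (g ⊕ d i)
      flip-apart g i≢j E = distinct _ i (i≢j ∘ sym) (cong reduce (flip-shift g _ _ E))

      twist-∞ : ∀ g → translate d (mul (pt g i) ∞) ≢ mul (pt (g ⊕ d i) i) ∞
      twist-∞ g rewrite to-∞ g | to-∞ (g ⊕ d i) with low? g | low? (g ⊕ d i)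
      ... | yes _ | yes _ = λ E → flip-apart g i≢i″ (pt-injective₁ E)
      ... | yes _ | no _  = λ E → flip-apart g i≢i″ (pt-injective₁ E)
      ... | no _  | yes _ = λ E → flip-apart g i≢i′ (pt-injective₁ E)
      ... | no _  | no _  = λ E → flip-apart g i≢i′ (pt-injective₁ E)

    private
      module T0 = TwistFromLevel 0F 1F 2F (λ ()) (λ ()) (λ _ _ → refl) (λ _ _ → refl) (λ _ → refl)
      module T1 = TwistFromLevel 1F 2F 0F (λ ()) (λ ()) (λ _ _ → refl) (λ _ _ → refl) (λ _ → refl)
      module T2 = TwistFromLevel 2F 0F 1F (λ ()) (λ ()) (λ _ _ → refl) (λ _ _ → refl) (λ _ → refl)

    translate-twists : ∀ p q → p ≢ q → translate d (mul p q) ≢ mul (translate d p) (translate d q)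
    translate-twists ∞         ∞         p≢q = contradiction refl p≢q
    translate-twists ∞         (pt g 0F) _   = T0.twist-∞ g
    translate-twists ∞         (pt g 1F) _   = T1.twist-∞ g
    translate-twists ∞         (pt g 2F) _   = T2.twist-∞ g
    translate-twists (pt g 0F) ∞         _   = T0.twist-∞ g
    translate-twists (pt g 1F) ∞         _   = T1.twist-∞ g
    translate-twists (pt g 2F) ∞         _   = T2.twist-∞ g
    translate-twists (pt x 0F) (pt y 0F) p≢q = T0.twist-same x y (λ e → p≢q (cong (λ z → pt z 0F) e))
    translate-twists (pt x 0F) (pt y 1F) _   = T0.twist-up x y
    translate-twists (pt x 0F) (pt y 2F) _   = T2.twist-up y x
    translate-twists (pt x 1F) (pt y 0F) _   = T0.twist-up y x
    translate-twists (pt x 1F) (pt y 1F) p≢q = T1.twist-same x y (λ e → p≢q (cong (λ z → pt z 1F) e))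
    translate-twists (pt x 1F) (pt y 2F) _   = T1.twist-up x y
    translate-twists (pt x 2F) (pt y 0F) _   = T2.twist-up x y
    translate-twists (pt x 2F) (pt y 1F) _   = T1.twist-up y x
    translate-twists (pt x 2F) (pt y 2F) p≢q = T2.twist-same x y (λ e → p≢q (cong (λ z → pt z 2F) e))

module SkolemTriple (n″ : ℕ) where

  open import Data.Nat using (suc; _*_; s≤s; z≤n)
  open import Data.Fin using (Fin; zero; suc; combine; remQuot)
  open import Data.Fin.Properties using (remQuot-combine; combine-remQuot)
  open import Data.Product using (proj₁; proj₂)
  open import Function using (_↔_; mk↔ₛ′; Inverse)
  open import Relation.Binary.PropositionalEquality
  open SteinerQuasigroups
  open Transport
  open Skolem (suc (suc n″))
  open Shifts.InCyclic (suc (suc n″)) (s≤s (s≤s (s≤s z≤n))) using (U; shift-differences-distinct)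

  -- The shifts, lifted from ℤ_n to ℤ_2n.
  Ũ : Fin 3 → Fin 3 → Z
  Ũ c i = mk (Shifts.shift c i)

  system : Fin 3 → SteinerQuasigroup Point
  system c = transport (translation (Ũ c)) skolem

  -- β⁻¹ ∘ α is translation by the shift differences δ, pairwise distinct modulo n.
  systems-disjoint : ∀ a b → a ≢ b → Disjoint (system a) (system b)
  systems-disjoint a b a≢b = conjugates-disjoint skolem (translation (Ũ a)) (translation (Ũ b)) twisted
    where
    δ : Fin 3 → Z
    δ i = Ũ a i ⊖ Ũ b i
    reduce-δ : ∀ i → reduce (δ i) ≡ U a i Zn.⊖ U b i
    reduce-δ i = trans (reduce-⊖ (Ũ a i) (Ũ b i)) (cong₂ Zn._⊖_ (reduce-mk (Shifts.shift a i)) (reduce-mk (Shifts.shift b i)))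
    δ-distinct : ∀ j k → j ≢ k → reduce (δ j) ≢ reduce (δ k)
    δ-distinct j k j≢k e = shift-differences-distinct a b a≢b j k j≢k (trans (sym (reduce-δ j)) (trans e (reduce-δ k)))
    γ : Point → Point
    γ p = Inverse.from (translation (Ũ b)) (Inverse.to (translation (Ũ a)) p)
    γ≡ : ∀ p → γ p ≡ translate δ p
    γ≡ ∞        = refl
    γ≡ (pt g i) = cong (λ z → pt z i) (⊕-assoc g (Ũ a i) (neg (Ũ b i)))
    twisted : ∀ p q → p ≢ q → γ (mul p q) ≢ mul (γ p) (γ q)
    twisted p q p≢q e = Twist.translate-twists δ δ-distinct p q p≢q
      (trans (sym (γ≡ (mul p q))) (trans e (cong₂ mul (γ≡ p) (γ≡ q))))

  v : ℕ
  v = suc (m * 3)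

  -- ∞ is point 0; (g, i) is point 1 + 3g + i.
  encoding : Point ↔ Fin v
  encoding = mk↔ₛ′ encode decode encode-decode decode-encode
    where
    encode : Point → Fin v
    encode ∞        = zero
    encode (pt g i) = suc (combine g i)
    decode : Fin v → Point
    decode zero    = ∞
    decode (suc k) = pt (proj₁ (remQuot {m} 3 k)) (proj₂ (remQuot {m} 3 k))
    encode-decode : ∀ k → encode (decode k) ≡ k
    encode-decode zero    = refl
    encode-decode (suc k) = cong suc (combine-remQuot {m} 3 k)
    decode-encode : ∀ p → decode (encode p) ≡ p
    decode-encode ∞        = refl
    decode-encode (pt g i) = cong₂ pt (cong proj₁ (remQuot-combine {m} {3} g i)) (cong proj₂ (remQuot-combine {m} {3} g i))

  quasigroups : Fin 3 → SQ v
  quasigroups c = transport encoding (system c)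

  quasigroups-disjoint : ∀ a b → a ≢ b → Disjoint (quasigroups a) (quasigroups b)
  quasigroups-disjoint a b a≢b = transport-disjoint encoding (system a) (system b) (systems-disjoint a b a≢b)

module Thirteen where

  open import Data.Fin using (Fin; zero; suc; #_; _≟_)
  open import Data.Fin.Properties using (all?)
  open import Data.Vec using (Vec; []; _∷_; lookup)
  open import Relation.Nullary.Decidable using (True; toWitness; _→-dec_; ¬?)
  open import Relation.Nullary using (contradiction)
  open import Relation.Binary.PropositionalEquality
  open SteinerQuasigroups

  Table : Set
  Table = Vec (Vec (Fin 13) 13) 13

  _·[_]_ : Fin 13 → Table → Fin 13 → Fin 13
  x ·[ t ] y = lookup (lookup t x) y

  from-table : (t : Table) →
    True (all? λ x → x ·[ t ] x ≟ x) →
    True (all? λ x → all? λ y → x ·[ t ] y ≟ y ·[ t ] x) →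
    True (all? λ x → all? λ y → x ·[ t ] (x ·[ t ] y) ≟ y) → SQ 13
  from-table t idem comm inv = record
    { op   = _·[ t ]_
    ; idem = toWitness idem
    ; comm = toWitness comm
    ; inv  = toWitness inv
    }

  tables-disjoint : ∀ t t′ {i c c′ i′ c″ c‴} →
    True (all? λ x → all? λ y → ¬? (x ≟ y) →-dec ¬? (x ·[ t ] y ≟ x ·[ t′ ] y)) →
    Disjoint (from-table t i c c′) (from-table t′ i′ c″ c‴)
  tables-disjoint t t′ check = toWitness check

  table₀ : Table
  table₀ = (# 0 ∷ # 4 ∷ # 7 ∷ # 12 ∷ # 1 ∷ # 11 ∷ # 8 ∷ # 2 ∷ # 6 ∷ # 10 ∷ # 9 ∷ # 5 ∷ # 3 ∷ [])
    ∷ (# 4 ∷ # 1 ∷ # 5 ∷ # 8 ∷ # 0 ∷ # 2 ∷ # 12 ∷ # 9 ∷ # 3 ∷ # 7 ∷ # 11 ∷ # 10 ∷ # 6 ∷ [])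
    ∷ (# 7 ∷ # 5 ∷ # 2 ∷ # 6 ∷ # 9 ∷ # 1 ∷ # 3 ∷ # 0 ∷ # 10 ∷ # 4 ∷ # 8 ∷ # 12 ∷ # 11 ∷ [])
    ∷ (# 12 ∷ # 8 ∷ # 6 ∷ # 3 ∷ # 7 ∷ # 10 ∷ # 2 ∷ # 4 ∷ # 1 ∷ # 11 ∷ # 5 ∷ # 9 ∷ # 0 ∷ [])
    ∷ (# 1 ∷ # 0 ∷ # 9 ∷ # 7 ∷ # 4 ∷ # 8 ∷ # 11 ∷ # 3 ∷ # 5 ∷ # 2 ∷ # 12 ∷ # 6 ∷ # 10 ∷ [])
    ∷ (# 11 ∷ # 2 ∷ # 1 ∷ # 10 ∷ # 8 ∷ # 5 ∷ # 9 ∷ # 12 ∷ # 4 ∷ # 6 ∷ # 3 ∷ # 0 ∷ # 7 ∷ [])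
    ∷ (# 8 ∷ # 12 ∷ # 3 ∷ # 2 ∷ # 11 ∷ # 9 ∷ # 6 ∷ # 10 ∷ # 0 ∷ # 5 ∷ # 7 ∷ # 4 ∷ # 1 ∷ [])
    ∷ (# 2 ∷ # 9 ∷ # 0 ∷ # 4 ∷ # 3 ∷ # 12 ∷ # 10 ∷ # 7 ∷ # 11 ∷ # 1 ∷ # 6 ∷ # 8 ∷ # 5 ∷ [])
    ∷ (# 6 ∷ # 3 ∷ # 10 ∷ # 1 ∷ # 5 ∷ # 4 ∷ # 0 ∷ # 11 ∷ # 8 ∷ # 12 ∷ # 2 ∷ # 7 ∷ # 9 ∷ [])
    ∷ (# 10 ∷ # 7 ∷ # 4 ∷ # 11 ∷ # 2 ∷ # 6 ∷ # 5 ∷ # 1 ∷ # 12 ∷ # 9 ∷ # 0 ∷ # 3 ∷ # 8 ∷ [])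
    ∷ (# 9 ∷ # 11 ∷ # 8 ∷ # 5 ∷ # 12 ∷ # 3 ∷ # 7 ∷ # 6 ∷ # 2 ∷ # 0 ∷ # 10 ∷ # 1 ∷ # 4 ∷ [])
    ∷ (# 5 ∷ # 10 ∷ # 12 ∷ # 9 ∷ # 6 ∷ # 0 ∷ # 4 ∷ # 8 ∷ # 7 ∷ # 3 ∷ # 1 ∷ # 11 ∷ # 2 ∷ [])
    ∷ (# 3 ∷ # 6 ∷ # 11 ∷ # 0 ∷ # 10 ∷ # 7 ∷ # 1 ∷ # 5 ∷ # 9 ∷ # 8 ∷ # 4 ∷ # 2 ∷ # 12 ∷ [])
    ∷ []

  table₁ : Table
  table₁ = (# 0 ∷ # 7 ∷ # 3 ∷ # 2 ∷ # 8 ∷ # 9 ∷ # 11 ∷ # 1 ∷ # 4 ∷ # 5 ∷ # 12 ∷ # 6 ∷ # 10 ∷ [])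
    ∷ (# 7 ∷ # 1 ∷ # 10 ∷ # 9 ∷ # 11 ∷ # 12 ∷ # 8 ∷ # 0 ∷ # 6 ∷ # 3 ∷ # 2 ∷ # 4 ∷ # 5 ∷ [])
    ∷ (# 3 ∷ # 10 ∷ # 2 ∷ # 0 ∷ # 5 ∷ # 4 ∷ # 12 ∷ # 9 ∷ # 11 ∷ # 7 ∷ # 1 ∷ # 8 ∷ # 6 ∷ [])
    ∷ (# 2 ∷ # 9 ∷ # 0 ∷ # 3 ∷ # 12 ∷ # 8 ∷ # 10 ∷ # 11 ∷ # 5 ∷ # 1 ∷ # 6 ∷ # 7 ∷ # 4 ∷ [])
    ∷ (# 8 ∷ # 11 ∷ # 5 ∷ # 12 ∷ # 4 ∷ # 2 ∷ # 9 ∷ # 10 ∷ # 0 ∷ # 6 ∷ # 7 ∷ # 1 ∷ # 3 ∷ [])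
    ∷ (# 9 ∷ # 12 ∷ # 4 ∷ # 8 ∷ # 2 ∷ # 5 ∷ # 7 ∷ # 6 ∷ # 3 ∷ # 0 ∷ # 11 ∷ # 10 ∷ # 1 ∷ [])
    ∷ (# 11 ∷ # 8 ∷ # 12 ∷ # 10 ∷ # 9 ∷ # 7 ∷ # 6 ∷ # 5 ∷ # 1 ∷ # 4 ∷ # 3 ∷ # 0 ∷ # 2 ∷ [])
    ∷ (# 1 ∷ # 0 ∷ # 9 ∷ # 11 ∷ # 10 ∷ # 6 ∷ # 5 ∷ # 7 ∷ # 12 ∷ # 2 ∷ # 4 ∷ # 3 ∷ # 8 ∷ [])
    ∷ (# 4 ∷ # 6 ∷ # 11 ∷ # 5 ∷ # 0 ∷ # 3 ∷ # 1 ∷ # 12 ∷ # 8 ∷ # 10 ∷ # 9 ∷ # 2 ∷ # 7 ∷ [])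
    ∷ (# 5 ∷ # 3 ∷ # 7 ∷ # 1 ∷ # 6 ∷ # 0 ∷ # 4 ∷ # 2 ∷ # 10 ∷ # 9 ∷ # 8 ∷ # 12 ∷ # 11 ∷ [])
    ∷ (# 12 ∷ # 2 ∷ # 1 ∷ # 6 ∷ # 7 ∷ # 11 ∷ # 3 ∷ # 4 ∷ # 9 ∷ # 8 ∷ # 10 ∷ # 5 ∷ # 0 ∷ [])
    ∷ (# 6 ∷ # 4 ∷ # 8 ∷ # 7 ∷ # 1 ∷ # 10 ∷ # 0 ∷ # 3 ∷ # 2 ∷ # 12 ∷ # 5 ∷ # 11 ∷ # 9 ∷ [])
    ∷ (# 10 ∷ # 5 ∷ # 6 ∷ # 4 ∷ # 3 ∷ # 1 ∷ # 2 ∷ # 8 ∷ # 7 ∷ # 11 ∷ # 0 ∷ # 9 ∷ # 12 ∷ [])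
    ∷ []

  table₂ : Table
  table₂ = (# 0 ∷ # 3 ∷ # 6 ∷ # 1 ∷ # 10 ∷ # 12 ∷ # 2 ∷ # 8 ∷ # 7 ∷ # 11 ∷ # 4 ∷ # 9 ∷ # 5 ∷ [])
    ∷ (# 3 ∷ # 1 ∷ # 4 ∷ # 0 ∷ # 2 ∷ # 10 ∷ # 7 ∷ # 6 ∷ # 9 ∷ # 8 ∷ # 5 ∷ # 12 ∷ # 11 ∷ [])
    ∷ (# 6 ∷ # 4 ∷ # 2 ∷ # 7 ∷ # 1 ∷ # 9 ∷ # 0 ∷ # 3 ∷ # 12 ∷ # 5 ∷ # 11 ∷ # 10 ∷ # 8 ∷ [])
    ∷ (# 1 ∷ # 0 ∷ # 7 ∷ # 3 ∷ # 5 ∷ # 4 ∷ # 11 ∷ # 2 ∷ # 10 ∷ # 12 ∷ # 8 ∷ # 6 ∷ # 9 ∷ [])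
    ∷ (# 10 ∷ # 2 ∷ # 1 ∷ # 5 ∷ # 4 ∷ # 3 ∷ # 12 ∷ # 9 ∷ # 11 ∷ # 7 ∷ # 0 ∷ # 8 ∷ # 6 ∷ [])
    ∷ (# 12 ∷ # 10 ∷ # 9 ∷ # 4 ∷ # 3 ∷ # 5 ∷ # 8 ∷ # 11 ∷ # 6 ∷ # 2 ∷ # 1 ∷ # 7 ∷ # 0 ∷ [])
    ∷ (# 2 ∷ # 7 ∷ # 0 ∷ # 11 ∷ # 12 ∷ # 8 ∷ # 6 ∷ # 1 ∷ # 5 ∷ # 10 ∷ # 9 ∷ # 3 ∷ # 4 ∷ [])
    ∷ (# 8 ∷ # 6 ∷ # 3 ∷ # 2 ∷ # 9 ∷ # 11 ∷ # 1 ∷ # 7 ∷ # 0 ∷ # 4 ∷ # 12 ∷ # 5 ∷ # 10 ∷ [])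
    ∷ (# 7 ∷ # 9 ∷ # 12 ∷ # 10 ∷ # 11 ∷ # 6 ∷ # 5 ∷ # 0 ∷ # 8 ∷ # 1 ∷ # 3 ∷ # 4 ∷ # 2 ∷ [])
    ∷ (# 11 ∷ # 8 ∷ # 5 ∷ # 12 ∷ # 7 ∷ # 2 ∷ # 10 ∷ # 4 ∷ # 1 ∷ # 9 ∷ # 6 ∷ # 0 ∷ # 3 ∷ [])
    ∷ (# 4 ∷ # 5 ∷ # 11 ∷ # 8 ∷ # 0 ∷ # 1 ∷ # 9 ∷ # 12 ∷ # 3 ∷ # 6 ∷ # 10 ∷ # 2 ∷ # 7 ∷ [])
    ∷ (# 9 ∷ # 12 ∷ # 10 ∷ # 6 ∷ # 8 ∷ # 7 ∷ # 3 ∷ # 5 ∷ # 4 ∷ # 0 ∷ # 2 ∷ # 11 ∷ # 1 ∷ [])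
    ∷ (# 5 ∷ # 11 ∷ # 8 ∷ # 9 ∷ # 6 ∷ # 0 ∷ # 4 ∷ # 10 ∷ # 2 ∷ # 3 ∷ # 7 ∷ # 1 ∷ # 12 ∷ [])
    ∷ []

  quasigroups : Fin 3 → SQ 13
  quasigroups zero             = from-table table₀ _ _ _
  quasigroups (suc zero)       = from-table table₁ _ _ _
  quasigroups (suc (suc zero)) = from-table table₂ _ _ _

  quasigroups-disjoint : ∀ a b → a ≢ b → Disjoint (quasigroups a) (quasigroups b)
  quasigroups-disjoint zero             zero             a≢b = contradiction refl a≢b
  quasigroups-disjoint zero             (suc zero)       _   = tables-disjoint table₀ table₁ _
  quasigroups-disjoint zero             (suc (suc zero)) _   = tables-disjoint table₀ table₂ _
  quasigroups-disjoint (suc zero)       zero             _   = tables-disjoint table₁ table₀ _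
  quasigroups-disjoint (suc zero)       (suc zero)       a≢b = contradiction refl a≢b
  quasigroups-disjoint (suc zero)       (suc (suc zero)) _   = tables-disjoint table₁ table₂ _
  quasigroups-disjoint (suc (suc zero)) zero             _   = tables-disjoint table₂ table₀ _
  quasigroups-disjoint (suc (suc zero)) (suc zero)       _   = tables-disjoint table₂ table₁ _
  quasigroups-disjoint (suc (suc zero)) (suc (suc zero)) a≢b = contradiction refl a≢b

module Families where

  open import Data.Nat using (suc; _+_; _*_; s≤s; z≤n)
  open import Data.Nat.Tactic.RingSolver using (solve-∀)
  open import Relation.Binary.PropositionalEquality using (_≡_; refl)
  open TradeFromQuasigroups using (HomogeneousSteinerTrade; steiner-trade)

  -- v = 3(2k + 1) with k = k′ + 1, and D = 3k + 1.
  bose-trade : ∀ k′ → HomogeneousSteinerTrade (BoseTriple.v k′)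
  bose-trade k′ = steiner-trade _ (3 * suc k′ + 1) (s≤s (s≤s (s≤s (s≤s z≤n)))) (v≡ k′)
    (BoseTriple.quasigroups k′) (BoseTriple.quasigroups-disjoint k′)
    where
    v≡ : ∀ k′ → 3 * suc k′ + 1 + (3 * suc k′ + 1) + 1 ≡ suc (suc k′ + suc k′) * 3
    v≡ = solve-∀

  -- v = 6n + 1 with n = n″ + 3, and D = 3n.
  skolem-trade : ∀ n″ → HomogeneousSteinerTrade (SkolemTriple.v n″)
  skolem-trade n″ = steiner-trade _ (3 * suc (suc (suc n″))) (s≤s (s≤s (s≤s (s≤s z≤n)))) (v≡ n″)
    (SkolemTriple.quasigroups n″) (SkolemTriple.quasigroups-disjoint n″)
    where
    v≡ : ∀ n″ → 3 * suc (suc (suc n″)) + 3 * suc (suc (suc n″)) + 1 ≡ suc (suc (suc (suc n″) + suc (suc (suc n″))) * 3)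
    v≡ = solve-∀

  thirteen-trade : HomogeneousSteinerTrade 13
  thirteen-trade = steiner-trade 13 6 (s≤s (s≤s (s≤s (s≤s z≤n)))) refl Thirteen.quasigroups Thirteen.quasigroups-disjoint

open import Defs using (Trade; IsSteiner; IsHomogeneous)
open import Data.Nat using (suc; _+_; _∸_; _*_; _<_; _%_; _/_; s≤s)
open import Data.Nat.DivMod using (m≡m%n+[m/n]*n)
open import Data.Nat.Tactic.RingSolver using (solve-∀)
open import Data.Sum using (_⊎_; inj₁; inj₂)
open import Data.Product using (Σ; _×_)
open import Relation.Nullary using (contradiction)
open import Relation.Binary.PropositionalEquality using (_≡_; _≢_; refl; sym; trans; cong; subst)
open TradeFromQuasigroups using (HomogeneousSteinerTrade)
open Families

by-residue : ∀ v {r} → v % 6 ≡ r → v ≡ r + (v / 6) * 6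
by-residue v v%6≡r = trans (m≡m%n+[m/n]*n v 6) (cong (_+ (v / 6) * 6) v%6≡r)

case-3 : ∀ v q → 3 < v → v ≡ 3 + q * 6 → HomogeneousSteinerTrade v
case-3 v 0       3<v refl = contradiction 3<v λ { (s≤s (s≤s (s≤s ()))) }
case-3 v (suc k′) _  v≡   = subst HomogeneousSteinerTrade (sym (trans v≡ (6k+3≡ k′))) (bose-trade k′)
  where
  6k+3≡ : ∀ k′ → 3 + suc k′ * 6 ≡ suc (suc k′ + suc k′) * 3
  6k+3≡ = solve-∀

case-1 : ∀ v n → 3 < v → v ≢ 7 → v ≡ 1 + n * 6 → HomogeneousSteinerTrade v
case-1 v 0 3<v _ refl = contradiction 3<v λ { (s≤s ()) }
case-1 v 1 _ v≢7 v≡7 = contradiction v≡7 v≢7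
case-1 v 2 _ _ refl = thirteen-trade
case-1 v (suc (suc (suc n″))) _ _ v≡ = subst HomogeneousSteinerTrade (sym (trans v≡ (6n+1≡ n″))) (skolem-trade n″)
  where
  6n+1≡ : ∀ n″ → 1 + suc (suc (suc n″)) * 6 ≡ suc (suc (suc (suc n″) + suc (suc (suc n″))) * 3)
  6n+1≡ = solve-∀

theorem1p9 : ∀ (v : ℕ) → (v % 6 ≡ 1 ⊎ v % 6 ≡ 3) → v ≢ 7 → 3 < v →
    Σ (Trade 3 v 3 2 ((v * (v ∸ 1)) / 6)) (λ T → IsSteiner T × IsHomogeneous ((v ∸ 1) / 2) T)
theorem1p9 v (inj₁ v%6≡1) v≢7 3<v = case-1 v (v / 6) 3<v v≢7 (by-residue v v%6≡1)
theorem1p9 v (inj₂ v%6≡3) _   3<v = case-3 v (v / 6) 3<v (by-residue v v%6≡3)
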